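{- Consider the following properties of a binary relation $R$: (1) $R$ is transitive; (2) $R$ is reflexive; (3) $R$ is symmetric; (4) $R$ is antireflexive (i.e. $x\,R\,x$ never holds); (5) $R$ is antisymmetric. For $P\subseteq\{1,2,3,4,5\}$ let $\mathcal{K}_P$ be the class of structures $(D,R)$ with one binary relation $R$ satisfying the properties listed in $P$. Then: (A) For every $P\subseteq\{1,2,3,4,5\}$, the class $\mathcal{K}_P$ has superSAP (with respect to $R$). (B) For each $P$, let $\mathcal{K}_P^f$ be the class of structures $(D,R,f)$ with $(D,R)\in\mathcal{K}_P$ and $f$ a unary operation which is $R$-preserving, i.e. $x\,R\,y$ implies $f(x)\,R\,f(y)$. Then $\mathcal{K}_P^f$ has superSAP. (C) For each $P$, let $\mathcal{K}_P^g$ be the class of structures $(D,R,g)$ with $(D,R)\in\mathcal{K}_P$ and $g$ a unary operation which is $R$-reversing, i.e. $x\,R\,y$ implies $g(y)\,R\,g(x)$. Then $\mathcal{K}_P^g$ has superSAP. (D) For each $P$ and every pair of sets $F,G$, let $\mathcal{K}_P^{F,G}$ be the class of structures obtained from members of $\mathcal{K}_P$ by adding an $F$-indexed family of $R$-preserving unary operations and a $G$-indexed family of $R$-reversing unary operations. Then $\mathcal{K}_P^{F,G}$ has superSAP. Moreover, for any one of the classes $\mathcal{K}$ considered in (A)–(D), the class $\mathcal{K}^{fin}$ of finite members of $\mathcal{K}$ has a Fraïssé limit, provided, in case (D), that $F$ and $G$ are finite. In case (A), for every $P\subseteq\{1,2,3,4,5\}$, if $\mathbf{M}$ is the Fraïssé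 limit of $\mathcal{K}_P^{fin}$, then the first-order theory $Th(\mathbf{M})$ is $\omega$-categorical and has quantifier elimination, and $Th(\mathbf{M})$ is the model completion of $Th(\mathcal{K}_P)$ (the set of first-order sentences true in all members of $\mathcal{K}_P$).
   Context: Structures are first-order structures; classes are closed under isomorphism and all members share the same signature; substructures and embeddings are in the usual model-theoretic sense (in particular substructures are closed under the operations). A triple to be amalgamated is $\mathbf{A},\mathbf{B},\mathbf{C}\in\mathcal{K}$ with $\mathbf{C}\subseteq\mathbf{A}$, $\mathbf{C}\subseteq\mathbf{B}$ (substructures) and $C=A\cap B$. $\mathcal{K}$ has the strong amalgamation property (SAP) if for every such triple there is $\mathbf{D}\in\mathcal{K}$ with $\mathbf{A}\subseteq\mathbf{D}$ and $\mathbf{B}\subseteq\mathbf{D}$. For a binary relation symbol $R$, $\mathcal{K}$ has superSAP (superamalgamation property) with respect to $R$ if for every such triple there is such a $\mathbf{D}\in\mathcal{K}$ with the additional property that for all $a\in A\setminus B$ and $b\in B\setminus A$: (i) if $a\,R_{\mathbf{D}}\,b$ then there is $c\in C$ with $a\,R_{\mathbf{A}}\,c$ and $c\,R_{\mathbf{B}}\,b$; (ii) if $b\,R_{\mathbf{D}}\,a$ then there is $c\in C$ with $b\,R_{\mathbf{B}}\,c$ and $c\,R_{\mathbf{A}}\,a$. A Fraïssé limit of a class $\mathcal{K}$ of finitely generated structures in a countable language is a countable ultrahomogeneous structure whose age (class of finitely generated structures embeddable in it) is $\mathcal{K}$. A theory $T$ has a model companion if it has the same universal consequences as some model complete theory $T^*$;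 if moreover $T$ has the amalgamation property, $T^*$ is called a model completion of $T$. -}

module Defs where

open import Level using (Level; Lift; Setω) renaming (suc to lsuc)
open import Data.Nat using (ℕ; zero; suc)
open import Data.Fin using (Fin; zero; suc)
open import Data.Fin.Subset using (Subset; _∈_)
open import Data.Empty using (⊥)
open import Data.Sum using (_⊎_)
open import Data.Product using (Σ; _×_; _,_; proj₁)
open import Relation.Nullary using (¬_; Dec)
open import Relation.Binary.PropositionalEquality using (_≡_)
open import Function.Bundles using (_⇔_; _↔_)
open import Data.Vec.Functional using (Vector; _∷_)

-- Case (A): F = G = ⊥ ; (B): F = ⊤, G = ⊥ ; (C): F = ⊥, G = ⊤.

record Str (F G : Set) : Set₁ where
  field
    Carrier : Set
    R       : Carrier → Carrier → Set
    f       : F → Carrier → Carrier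
    g       : G → Carrier → Carrier
open Str public

record Emb {F G : Set} (A B : Str F G) : Set where
  field
    map   : Carrier A → Carrier B
    inj   : ∀ {x y} → map x ≡ map y → x ≡ y
    rel-iff : ∀ x y → R A x y ⇔ R B (map x) (map y)
    f-hom : ∀ i x → map (f A i x) ≡ f B i (map x)
    g-hom : ∀ j x → map (g A j x) ≡ g B j (map x)
open Emb public

Iso : {F G : Set} → Str F G → Str F G → Set
Iso A B = Σ (Emb A B) λ e → ∀ y → Σ (Carrier A) λ x → map e x ≡ y

InImage : {F G : Set} {A B : Str F G} → Emb A B → Carrier B → Set
InImage {A = A} e b = Σ (Carrier A) λ a → map e a ≡ b

-- The five properties of R, numbered 1..5 as Fin 5 = 0..4

RelProp : {D : Set} → Fin 5 → (D → D → Set) → Set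
RelProp zero R = ∀ {x y z} → R x y → R y z → R x z
RelProp (suc zero) R = ∀ x → R x x
RelProp (suc (suc zero)) R = ∀ {x y} → R x y → R y x
RelProp (suc (suc (suc zero))) R = ∀ x → ¬ R x x
RelProp (suc (suc (suc (suc zero)))) R =
  ∀ {x y} → R x y → R y x → x ≡ y

InKP : {F G : Set} → Subset 5 → Str F G → Set
InKP P A = ∀ i → i ∈ P → RelProp i (R A)

Preserving : {F G : Set} → Str F G → Set
Preserving A = ∀ i x y → R A x y → R A (f A i x) (f A i y)

Reversing : {F G : Set} → Str F G → Set
Reversing A = ∀ j x y → R A x y → R A (g A j y) (g A j x)

InK : {F G : Set} → Subset 5 → Str F G → Set
InK P A = InKP P A × Preserving A × Reversing A

-- superSAP w.r.t. R (embedding formulation of the triple C = A ∩ B)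

SuperSAP : {F G : Set} → (Str F G → Set) → Set₁
SuperSAP {F} {G} K =
  (A B C : Str F G) → K A → K B → K C → (iA : Emb C A) (iB : Emb C B) →
  Σ (Str F G) λ D → K D × Σ (Emb A D) λ eA → Σ (Emb B D) λ eB →
    (∀ c → map eA (map iA c) ≡ map eB (map iB c))
  × (∀ a b → map eA a ≡ map eB b →
       Σ (Carrier C) λ c → (map iA c ≡ a) × (map iB c ≡ b))
  × (∀ a b → ¬ InImage iA a → ¬ InImage iB b → R D (map eA a) (map eB b) →
       Σ (Carrier C) λ c → R A a (map iA c) × R B (map iB c) b)
  × (∀ a b → ¬ InImage iA a → ¬ InImage iB b → R D (map eB b) (map eA a) →
       Σ (Carrier C) λ c → R B b (map iB c) × R A (map iA c) a)

data Term (F G : Set) (n : ℕ) : Set where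
  var  : Fin n → Term F G n
  fapp : F → Term F G n → Term F G n
  gapp : G → Term F G n → Term F G n

data Formula (F G : Set) : ℕ → Set where
  ⊥ᶠ   : ∀ {n} → Formula F G n
  _≐_  : ∀ {n} → Term F G n → Term F G n → Formula F G n
  rel  : ∀ {n} → Term F G n → Term F G n → Formula F G n
  _⇒_  : ∀ {n} → Formula F G n → Formula F G n → Formula F G n
  _∧ᶠ_ : ∀ {n} → Formula F G n → Formula F G n → Formula F G n
  _∨ᶠ_ : ∀ {n} → Formula F G n → Formula F G n → Formula F G n
  ∀ᶠ   : ∀ {n} → Formula F G (suc n) → Formula F G n
  ∃ᶠ   : ∀ {n} → Formula F G (suc n) → Formula F G n

Sentence : Set → Set → Set
Sentence F G = Formula F G 0

data QF {F G : Set} : ∀ {n} → Formula F G n → Set where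
  qf-⊥ : ∀ {n} → QF {n = n} ⊥ᶠ
  qf-≐ : ∀ {n} (s t : Term F G n) → QF (s ≐ t)
  qf-R : ∀ {n} (s t : Term F G n) → QF (rel s t)
  qf-⇒ : ∀ {n} {φ ψ : Formula F G n} → QF φ → QF ψ → QF (φ ⇒ ψ)
  qf-∧ : ∀ {n} {φ ψ : Formula F G n} → QF φ → QF ψ → QF (φ ∧ᶠ ψ)
  qf-∨ : ∀ {n} {φ ψ : Formula F G n} → QF φ → QF ψ → QF (φ ∨ᶠ ψ)

data Universal {F G : Set} : ∀ {n} → Formula F G n → Set where
  univ-qf : ∀ {n} {φ : Formula F G n} → QF φ → Universal φ
  univ-∀  : ∀ {n} {φ : Formula F G (suc n)} → Universal φ → Universal (∀ᶠ φ)

⟦_⟧t_ : {F G : Set} {n : ℕ} → Term F G n → (A : Str F G) → Vector (Carrier A) n → Carrier A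
(⟦ var x ⟧t A) ρ = ρ x
(⟦ fapp i t ⟧t A) ρ = f A i ((⟦ t ⟧t A) ρ)
(⟦ gapp j t ⟧t A) ρ = g A j ((⟦ t ⟧t A) ρ)

_⊨_[_] : {F G : Set} {n : ℕ} (A : Str F G) → Formula F G n → Vector (Carrier A) n → Set
A ⊨ ⊥ᶠ [ ρ ] = ⊥
A ⊨ s ≐ t [ ρ ] = (⟦ s ⟧t A) ρ ≡ (⟦ t ⟧t A) ρ
A ⊨ rel s t [ ρ ] = R A ((⟦ s ⟧t A) ρ) ((⟦ t ⟧t A) ρ)
A ⊨ φ ⇒ ψ [ ρ ] = A ⊨ φ [ ρ ] → A ⊨ ψ [ ρ ]
A ⊨ φ ∧ᶠ ψ [ ρ ] = A ⊨ φ [ ρ ] × A ⊨ ψ [ ρ ]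
A ⊨ φ ∨ᶠ ψ [ ρ ] = A ⊨ φ [ ρ ] ⊎ A ⊨ ψ [ ρ ]
A ⊨ ∀ᶠ φ [ ρ ] = (d : Carrier A) → A ⊨ φ [ d ∷ ρ ]
A ⊨ ∃ᶠ φ [ ρ ] = Σ (Carrier A) λ d → A ⊨ φ [ d ∷ ρ ]

_⊨ˢ_ : {F G : Set} (A : Str F G) → Sentence F G → Set
A ⊨ˢ σ = A ⊨ σ [ (λ ()) ]

Theory : Set → Set → Set₂
Theory F G = Sentence F G → Set₁

Th : {F G : Set} → Str F G → Theory F G
Th M σ = Lift _ (M ⊨ˢ σ)

ThK : {F G : Set} → (Str F G → Set) → Theory F G
ThK K σ = (A : Str _ _) → K A → A ⊨ˢ σ

Model : {F G : Set} → Theory F G → Str F G → Set₁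
Model T A = ∀ σ → T σ → A ⊨ˢ σ

_⊢_ : {F G : Set} → Theory F G → Sentence F G → Set₁
T ⊢ σ = (A : Str _ _) → Model T A → A ⊨ˢ σ

ωCategorical : {F G : Set} → Theory F G → Set₁
ωCategorical T = (A B : Str _ _) → Model T A → Model T B →
  (Carrier A ↔ ℕ) → (Carrier B ↔ ℕ) → Iso A B

QE : {F G : Set} → Theory F G → Set₁
QE {F} {G} T = (n : ℕ) (φ : Formula F G n) → Σ (Formula F G n) λ ψ → QF ψ ×
  ((A : Str F G) → Model T A → (ρ : Vector (Carrier A) n) → (A ⊨ φ [ ρ ]) ⇔ (A ⊨ ψ [ ρ ]))

ModelComplete : {F G : Set} → Theory F G → Set₁
ModelComplete {F} {G} T = (A B : Str F G) → Model T A → Model T B → (e : Emb A B) →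
  (n : ℕ) (φ : Formula F G n) (ρ : Vector (Carrier A) n) →
  (A ⊨ φ [ ρ ]) ⇔ (B ⊨ φ [ (λ k → map e (ρ k)) ])

SameUniversalConsequences : {F G : Set} → Theory F G → Theory F G → Set₁
SameUniversalConsequences T T' = ∀ σ → Universal σ → (T ⊢ σ) ⇔ (T' ⊢ σ)

AP : {F G : Set} → Theory F G → Set₁
AP {F} {G} T = (A B C : Str F G) → Model T A → Model T B → Model T C →
  (iA : Emb C A) (iB : Emb C B) →
  Σ (Str F G) λ D → Model T D × Σ (Emb A D) λ eA → Σ (Emb B D) λ eB →
    (∀ c → map eA (map iA c) ≡ map eB (map iB c))

ModelCompletion : {F G : Set} → Theory F G → Theory F G → Set₁
ModelCompletion T* T = ModelComplete T* × SameUniversalConsequences T T* × AP T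

FinitelyGenerated : {F G : Set} → Str F G → Set
FinitelyGenerated {F} {G} A = Σ ℕ λ n → Σ (Vector (Carrier A) n) λ gens →
  ∀ d → Σ (Term F G n) λ t → (⟦ t ⟧t A) gens ≡ d

FiniteSet : Set → Set
FiniteSet X = Σ ℕ λ n → X ↔ Fin n

FiniteStr : {F G : Set} → Str F G → Set
FiniteStr A = FiniteSet (Carrier A)

Countable : {F G : Set} → Str F G → Set
Countable A = Σ (Carrier A → ℕ) λ h → ∀ {x y} → h x ≡ h y → x ≡ y

-- ultrahomogeneity, in the (standard, equivalent) embedding form:
-- any two embeddings of a finitely generated structure into M differ by
-- an automorphism of M
Ultrahomogeneous : {F G : Set} → Str F G → Set₁
Ultrahomogeneous {F} {G} M = (A : Str F G) → FinitelyGenerated A →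
  (e₁ e₂ : Emb A M) → Σ (Iso M M) λ σ → ∀ a → map (proj₁ σ) (map e₁ a) ≡ map e₂ a

-- age(M) = K  (K closed under isomorphism)
AgeIs : {F G : Set} → Str F G → (Str F G → Set) → Set₁
AgeIs M K = (A : Str _ _) → (FinitelyGenerated A × Emb A M) ⇔ K A

FraisseLimit : {F G : Set} → (Str F G → Set) → Str F G → Set₁
FraisseLimit K M = Countable M × Ultrahomogeneous M × AgeIs M K

Fin-part : {F G : Set} → (Str F G → Set) → Str F G → Set
Fin-part K A = FiniteStr A × K A

ExcludedMiddle : Setω
ExcludedMiddle = ∀ {ℓ : Level} (X : Set ℓ) → Dec X

-- In the amalgam of A and B over C, take the disjoint union of A and B ∖ C and relate
-- a ∈ A with b ∈ B ∖ C only through C: a ≤ c R b for some c ∈ C, where a ≤ c means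
-- a = c or, when P asks for transitivity, a R c (symmetrically for b R a). This is the free
-- amalgam, closed under transitivity when required; each of the five properties, and the
-- preservation or reversal of R by the operations, carries over from A and B, and relations
-- between the new points factor through C by construction, which is superSAP.
--
-- For finitely many operations, finite structures on Fin N are coded by finite data, so
-- there are countably many tasks "extend stage k by m new points"; performing all of them by
-- amalgamation along a chain gives a countable direct limit with the extension property,
-- hence with age K^fin, and back and forth along finite partial isomorphisms makes it
-- ultrahomogeneous. In case (A) the signature is relational, so the atomic type of a tuple
-- is a finite diagram, and tuples of one diagram are conjugate under an automorphism of the
-- limit M. Thus every formula is equivalent in M to the disjunction of the diagrams of its
-- solutions (quantifier elimination, whence model completeness), countable models of Th M
-- are isomorphic by back and forth on diagrams, and universal sentences pass between M and
-- K_P through finite substructures. Excluded middle is used to split B into C and B ∖ C, to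
-- decide which tasks are possible, and to read off diagrams.

module Submission where

open import Level using (lift; lower)
open import Function using (_∘_)
open import Function.Bundles using (_⇔_; mk⇔; Equivalence; _↔_; mk↔ₛ′; Inverse; Injection)
open import Function.Construct.Composition using (_⇔-∘_)
open import Function.Properties.Equivalence using () renaming (refl to ⇔-refl; sym to ⇔-sym)
open import Function.Properties.Inverse using (↔-refl; ↔-sym; ↔-trans; Inverse⇒Injection)
open import Function.Related.TypeIsomorphisms using (→-cong-⇔)
open import Relation.Binary.PropositionalEquality
  using (_≡_; _≢_; refl; sym; trans; cong; subst; subst₂; module ≡-Reasoning)
open import Relation.Nullary using (¬_; Dec; yes; no)
open import Relation.Nullary.Decidable using (True; fromWitness; toWitness; isYes)
open import Data.Empty using (⊥; ⊥-elim)
open import Data.Unit using (⊤; tt)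
open import Data.Bool using (Bool; true; false; T)
open import Data.Bool.Properties using (T-irrelevant)
open import Data.Maybe using (Maybe; just; nothing)
open import Data.Sum using (_⊎_; inj₁; inj₂)
open import Data.Sum.Properties using (inj₁-injective; inj₂-injective)
open import Data.Sum.Function.Propositional using (_⊎-↔_; _⊎-⇔_)
open import Data.Product using (Σ; _×_; _,_; proj₁; proj₂)
open import Data.Product.Function.NonDependent.Propositional using (_×-⇔_)
open import Data.Nat using (ℕ; zero; suc; _+_; _≤_; _≤′_; ≤′-refl; ≤′-step; z≤n; s≤s)
open import Data.Nat.Properties
  using (+-identityʳ; +-suc; suc-injective; m≤m+n; m≤n+m; ≤-refl; ≤-trans; m≤n⇒m≤1+n; ≤⇒≤′; 1+n≰n;
         m≤n⇒m<n∨m≡n; ≤-pred)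
open import Data.Fin using (Fin; zero; suc; _↑ˡ_; punchOut; toℕ)
open import Data.Fin.Properties using (+↔⊎; 1↔⊤; 0↔⊥; ¬Fin0; punchOut-injective; toℕ-injective)
open import Data.Fin.Subset using (Subset) renaming (_∈_ to _∈ˢ_)
open import Data.Vec as Vec using (Vec; []; _∷_)
open import Data.Vec.Properties using (lookup∘tabulate)
open import Data.Vec.Functional using (Vector) renaming (_∷_ to _∷ᵛ_; [] to []ᵛ)
open import Data.List as List
  using (List; []; _∷_; _++_; length; filter; allFin; cartesianProduct; cartesianProductWith)
open import Data.List.Membership.Propositional using (_∈_)
open import Data.List.Membership.Propositional.Properties
  using (∈-allFin; ∈-filter⁺; ∈-filter⁻; ∈-cartesianProduct⁺; ∈-cartesianProductWith⁺; ∈-map⁺; ∈-map⁻; ∈-++⁺ˡ; ∈-++⁺ʳ)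
open import Data.List.Relation.Unary.Any using (here; there; index)
open import Data.List.Relation.Unary.Any.Properties using (lookup-index)

open import Defs

open ≡-Reasoning
open Equivalence using (to; from)
open Inverse using (to; from; strictlyInverseˡ; strictlyInverseʳ)

pattern transitive    = zero
pattern reflexive     = suc zero
pattern symmetric     = suc (suc zero)
pattern antireflexive = suc (suc (suc zero))
pattern antisymmetric = suc (suc (suc (suc zero)))

variable
  F G : Set

id-emb : (A : Str F G) → Emb A A
id-emb A = record { map = λ x → x ; inj = λ e → e ; rel-iff = λ _ _ → ⇔-refl
                  ; f-hom = λ _ _ → refl ; g-hom = λ _ _ → refl }

infixr 9 _∘ᵉ_
_∘ᵉ_ : {A B C : Str F G} → Emb B C → Emb A B → Emb A C
q ∘ᵉ p = record
  { map = λ x → map q (map p x)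
  ; inj = λ e → inj p (inj q e)
  ; rel-iff = λ x y → rel-iff q (map p x) (map p y) ⇔-∘ rel-iff p x y
  ; f-hom = λ i x → trans (cong (map q) (f-hom p i x)) (f-hom q i (map p x))
  ; g-hom = λ j x → trans (cong (map q) (g-hom p j x)) (g-hom q j (map p x)) }

R-reflect : {A B : Str F G} (e : Emb A B) {x y : Carrier A} → R B (map e x) (map e y) → R A x y
R-reflect e = from (rel-iff e _ _)

R-preserve : {A B : Str F G} (e : Emb A B) {x y : Carrier A} → R A x y → R B (map e x) (map e y)
R-preserve e = to (rel-iff e _ _)

R-cong : (X : Str F G) {x x′ y y′ : Carrier X} → x ≡ x′ → y ≡ y′ → R X x y ⇔ R X x′ y′
R-cong X refl refl = ⇔-refl

InKP-substructure : (P : Subset 5) {X Y : Str F G} → Emb Y X → InKP P X → InKP P Y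
InKP-substructure P e kX transitive p r r′ = R-reflect e (kX transitive p (R-preserve e r) (R-preserve e r′))
InKP-substructure P e kX reflexive p x = R-reflect e (kX reflexive p (map e x))
InKP-substructure P e kX symmetric p r = R-reflect e (kX symmetric p (R-preserve e r))
InKP-substructure P e kX antireflexive p x r = kX antireflexive p (map e x) (R-preserve e r)
InKP-substructure P e kX antisymmetric p r r′ = inj e (kX antisymmetric p (R-preserve e r) (R-preserve e r′))

InK-substructure : (P : Subset 5) {X Y : Str F G} → Emb Y X → InK P X → InK P Y
InK-substructure P {X} {Y} e (kX , pres , rev) = InKP-substructure P e kX , pres′ , rev′
  where
  pres′ : Preserving Y
  pres′ i x y r = R-reflect e (subst₂ (R X) (sym (f-hom e i x)) (sym (f-hom e i y)) (pres i _ _ (R-preserve e r)))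
  rev′ : Reversing Y
  rev′ j x y r = R-reflect e (subst₂ (R X) (sym (g-hom e j y)) (sym (g-hom e j x)) (rev j _ _ (R-preserve e r)))

factor-through : {A B X : Str F G} (j : Emb B X) (e : Emb A X) → (∀ x → InImage j (map e x)) →
  Σ (Emb A B) λ e′ → ∀ x → map j (map e′ x) ≡ map e x
factor-through {A = A} {B} {X} j e covered = e′ , j∘e′
  where
  e′-map : Carrier A → Carrier B
  e′-map x = proj₁ (covered x)
  j∘e′ : ∀ x → map j (e′-map x) ≡ map e x
  j∘e′ x = proj₂ (covered x)
  e′ : Emb A B
  e′ = record
    { map = e′-map
    ; inj = λ {x} {y} q → inj e (trans (sym (j∘e′ x)) (trans (cong (map j) q) (j∘e′ y)))
    ; rel-iff = λ x y → ⇔-sym (rel-iff j _ _) ⇔-∘ (R-cong X (sym (j∘e′ x)) (sym (j∘e′ y)) ⇔-∘ rel-iff e x y)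
    ; f-hom = λ i x → inj j (trans (j∘e′ (f A i x)) (trans (f-hom e i x) (trans (cong (f X i) (sym (j∘e′ x))) (sym (f-hom j i _)))))
    ; g-hom = λ i x → inj j (trans (j∘e′ (g A i x)) (trans (g-hom e i x) (trans (cong (g X i) (sym (j∘e′ x))) (sym (g-hom j i _)))))
    }

Iso-inverse : {A B : Str F G} → Iso A B → Emb B A
Iso-inverse (e , onto) = proj₁ (factor-through e (id-emb _) onto)

InK-local : (P : Subset 5) (X : Str F G) →
  (∀ x y z → Σ (Str F G) λ Y → InK P Y × Σ (Emb Y X) λ e → InImage e x × InImage e y × InImage e z) →
  InK P X
InK-local {F} {G} P X local = kX , pres , rev
  where
  kX : InKP P X
  kX transitive p {x} {y} {z} r r′ with local x y z
  ... | Y , kY , e , (_ , refl) , (_ , refl) , (_ , refl) =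
    R-preserve e (proj₁ kY transitive p (R-reflect e r) (R-reflect e r′))
  kX reflexive p x with local x x x
  ... | Y , kY , e , (x′ , refl) , _ = R-preserve e (proj₁ kY reflexive p x′)
  kX symmetric p {x} {y} r with local x y y
  ... | Y , kY , e , (_ , refl) , (_ , refl) , _ = R-preserve e (proj₁ kY symmetric p (R-reflect e r))
  kX antireflexive p x r with local x x x
  ... | Y , kY , e , (x′ , refl) , _ = proj₁ kY antireflexive p x′ (R-reflect e r)
  kX antisymmetric p {x} {y} r r′ with local x y y
  ... | Y , kY , e , (_ , refl) , (_ , refl) , _ =
    cong (map e) (proj₁ kY antisymmetric p (R-reflect e r) (R-reflect e r′))
  pres : Preserving X
  pres i x y r with local x y y
  ... | Y , kY , e , (x′ , refl) , (y′ , refl) , _ =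
    subst₂ (R X) (f-hom e i x′) (f-hom e i y′) (R-preserve e (proj₁ (proj₂ kY) i x′ y′ (R-reflect e r)))
  rev : Reversing X
  rev j x y r with local x y y
  ... | Y , kY , e , (x′ , refl) , (y′ , refl) , _ =
    subst₂ (R X) (g-hom e j y′) (g-hom e j x′) (R-preserve e (proj₂ (proj₂ kY) j x′ y′ (R-reflect e r)))

∅ˢ : Str F G
∅ˢ = record { Carrier = ⊥ ; R = λ _ _ → ⊥ ; f = λ _ () ; g = λ _ () }

∅ˢ-InK : (P : Subset 5) → InK P (∅ˢ {F} {G})
∅ˢ-InK {F} {G} P = kP , (λ _ ()) , (λ _ ())
  where
  kP : InKP P (∅ˢ {F} {G})
  kP transitive _ ()
  kP reflexive _ ()
  kP symmetric _ ()
  kP antireflexive _ ()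
  kP antisymmetric _ ()

∅ˢ-emb : (A : Str F G) → Emb ∅ˢ A
∅ˢ-emb A = record { map = λ () ; inj = λ {x} → ⊥-elim x ; rel-iff = λ () ; f-hom = λ _ () ; g-hom = λ _ () }

term-cong : ∀ {n} (A : Str F G) (t : Term F G n) {ρ ρ′ : Vector (Carrier A) n} →
  (∀ i → ρ i ≡ ρ′ i) → (⟦ t ⟧t A) ρ ≡ (⟦ t ⟧t A) ρ′
term-cong A (var i) e = e i
term-cong A (fapp i t) e = cong (f A i) (term-cong A t e)
term-cong A (gapp j t) e = cong (g A j) (term-cong A t e)

term-emb : ∀ {n} {A B : Str F G} (e : Emb A B) (t : Term F G n) ρ →
  map e ((⟦ t ⟧t A) ρ) ≡ (⟦ t ⟧t B) (λ k → map e (ρ k))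
term-emb e (var i) ρ = refl
term-emb {B = B} e (fapp i t) ρ = trans (f-hom e i _) (cong (f B i) (term-emb e t ρ))
term-emb {B = B} e (gapp j t) ρ = trans (g-hom e j _) (cong (g B j) (term-emb e t ρ))

≡-cong-⇔ : {X : Set} {x x′ y y′ : X} → x ≡ x′ → y ≡ y′ → (x ≡ y) ⇔ (x′ ≡ y′)
≡-cong-⇔ refl refl = ⇔-refl

Π-⇔ : {X : Set} {Y Z : X → Set} → (∀ x → Y x ⇔ Z x) → (∀ x → Y x) ⇔ (∀ x → Z x)
Π-⇔ e = mk⇔ (λ h x → to (e x) (h x)) (λ h x → from (e x) (h x))

Σ-⇔ : {X : Set} {Y Z : X → Set} → (∀ x → Y x ⇔ Z x) → Σ X Y ⇔ Σ X Z
Σ-⇔ e = mk⇔ (λ (x , y) → x , to (e x) y) (λ (x , z) → x , from (e x) z)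

∷-cong : ∀ {n} {X : Set} (d : X) {ρ ρ′ : Vector X n} → (∀ i → ρ i ≡ ρ′ i) → ∀ i → (d ∷ᵛ ρ) i ≡ (d ∷ᵛ ρ′) i
∷-cong d e zero = refl
∷-cong d e (suc i) = e i

∷-η : ∀ {n} {X : Set} (ρ : Vector X (suc n)) → ∀ i → ρ i ≡ (ρ zero ∷ᵛ (λ k → ρ (suc k))) i
∷-η ρ zero = refl
∷-η ρ (suc i) = refl

∘-∷ : ∀ {n} {X Y : Set} (h : X → Y) (d : X) (ρ : Vector X n) → ∀ i → h ((d ∷ᵛ ρ) i) ≡ (h d ∷ᵛ (λ k → h (ρ k))) i
∘-∷ h d ρ zero = refl
∘-∷ h d ρ (suc i) = refl

⊨-cong : ∀ {n} (A : Str F G) (φ : Formula F G n) {ρ ρ′ : Vector (Carrier A) n} →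
  (∀ i → ρ i ≡ ρ′ i) → (A ⊨ φ [ ρ ]) ⇔ (A ⊨ φ [ ρ′ ])
⊨-cong A ⊥ᶠ e = ⇔-refl
⊨-cong A (s ≐ t) e = ≡-cong-⇔ (term-cong A s e) (term-cong A t e)
⊨-cong A (rel s t) e = R-cong A (term-cong A s e) (term-cong A t e)
⊨-cong A (φ ⇒ ψ) e = →-cong-⇔ (⊨-cong A φ e) (⊨-cong A ψ e)
⊨-cong A (φ ∧ᶠ ψ) e = ⊨-cong A φ e ×-⇔ ⊨-cong A ψ e
⊨-cong A (φ ∨ᶠ ψ) e = ⊨-cong A φ e ⊎-⇔ ⊨-cong A ψ e
⊨-cong A (∀ᶠ φ) e = Π-⇔ λ d → ⊨-cong A φ (∷-cong d e)
⊨-cong A (∃ᶠ φ) e = Σ-⇔ λ d → ⊨-cong A φ (∷-cong d e)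

QF-emb : ∀ {n} {A B : Str F G} (e : Emb A B) {φ : Formula F G n} → QF φ → ∀ ρ →
  (A ⊨ φ [ ρ ]) ⇔ (B ⊨ φ [ (λ k → map e (ρ k)) ])
QF-emb e qf-⊥ ρ = ⇔-refl
QF-emb e (qf-≐ s t) ρ = ≡-cong-⇔ (term-emb e s ρ) (term-emb e t ρ) ⇔-∘ mk⇔ (cong (map e)) (inj e)
QF-emb {B = B} e (qf-R s t) ρ = R-cong B (term-emb e s ρ) (term-emb e t ρ) ⇔-∘ rel-iff e _ _
QF-emb e (qf-⇒ p q) ρ = →-cong-⇔ (QF-emb e p ρ) (QF-emb e q ρ)
QF-emb e (qf-∧ p q) ρ = QF-emb e p ρ ×-⇔ QF-emb e q ρ
QF-emb e (qf-∨ p q) ρ = QF-emb e p ρ ⊎-⇔ QF-emb e q ρ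

Iso-preserves : ∀ {n} {A B : Str F G} (σ : Iso A B) (φ : Formula F G n) ρ →
  (A ⊨ φ [ ρ ]) ⇔ (B ⊨ φ [ (λ k → map (proj₁ σ) (ρ k)) ])
Iso-preserves σ ⊥ᶠ ρ = ⇔-refl
Iso-preserves σ (s ≐ t) ρ = QF-emb (proj₁ σ) (qf-≐ s t) ρ
Iso-preserves σ (rel s t) ρ = QF-emb (proj₁ σ) (qf-R s t) ρ
Iso-preserves σ (φ ⇒ ψ) ρ = →-cong-⇔ (Iso-preserves σ φ ρ) (Iso-preserves σ ψ ρ)
Iso-preserves σ (φ ∧ᶠ ψ) ρ = Iso-preserves σ φ ρ ×-⇔ Iso-preserves σ ψ ρ
Iso-preserves σ (φ ∨ᶠ ψ) ρ = Iso-preserves σ φ ρ ⊎-⇔ Iso-preserves σ ψ ρ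
Iso-preserves {B = B} σ@(e , onto) (∀ᶠ φ) ρ = mk⇔
  (λ h d′ → subst (λ d → B ⊨ φ [ d ∷ᵛ _ ]) (proj₂ (onto d′)) (to (step (proj₁ (onto d′))) (h _)))
  (λ h d → from (step d) (h (map e d)))
  where
  step : ∀ d → (_ ⊨ φ [ d ∷ᵛ ρ ]) ⇔ (B ⊨ φ [ map e d ∷ᵛ (λ k → map e (ρ k)) ])
  step d = ⊨-cong B φ (∘-∷ (map e) d ρ) ⇔-∘ Iso-preserves σ φ (d ∷ᵛ ρ)
Iso-preserves {B = B} σ@(e , onto) (∃ᶠ φ) ρ = mk⇔
  (λ (d , h) → map e d , to (step d) h)
  (λ (d′ , h) → proj₁ (onto d′) , from (step _) (subst (λ d → B ⊨ φ [ d ∷ᵛ _ ]) (sym (proj₂ (onto d′))) h))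
  where
  step : ∀ d → (_ ⊨ φ [ d ∷ᵛ ρ ]) ⇔ (B ⊨ φ [ map e d ∷ᵛ (λ k → map e (ρ k)) ])
  step d = ⊨-cong B φ (∘-∷ (map e) d ρ) ⇔-∘ Iso-preserves σ φ (d ∷ᵛ ρ)

⋀ : ∀ {n} k → (Fin k → Formula F G n) → Formula F G n
⋀ zero φ = ⊥ᶠ ⇒ ⊥ᶠ
⋀ (suc k) φ = φ zero ∧ᶠ ⋀ k (λ i → φ (suc i))

⊨-⋀ : ∀ {n} (A : Str F G) k (φ : Fin k → Formula F G n) ρ → (A ⊨ ⋀ k φ [ ρ ]) ⇔ (∀ i → A ⊨ φ i [ ρ ])
⊨-⋀ A zero φ ρ = mk⇔ (λ _ ()) (λ _ x → x)
⊨-⋀ A (suc k) φ ρ = mk⇔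
  (λ { (h₀ , h) zero → h₀ ; (h₀ , h) (suc i) → to (⊨-⋀ A k _ ρ) h i })
  (λ h → h zero , from (⊨-⋀ A k _ ρ) (λ i → h (suc i)))

⋀-QF : ∀ {n} k (φ : Fin k → Formula F G n) → (∀ i → QF (φ i)) → QF (⋀ k φ)
⋀-QF zero φ q = qf-⇒ qf-⊥ qf-⊥
⋀-QF (suc k) φ q = qf-∧ (q zero) (⋀-QF k _ (λ i → q (suc i)))

∀* : ∀ n → Formula F G n → Sentence F G
∀* zero φ = φ
∀* (suc n) φ = ∀* n (∀ᶠ φ)

∃* : ∀ n → Formula F G n → Sentence F G
∃* zero φ = φ
∃* (suc n) φ = ∃* n (∃ᶠ φ)

⊨-∀* : ∀ (A : Str F G) n (φ : Formula F G n) → (A ⊨ˢ ∀* n φ) ⇔ (∀ ρ → A ⊨ φ [ ρ ])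
⊨-∀* A zero φ = mk⇔ (λ h ρ → to (⊨-cong A φ (λ ())) h) (λ h → h (λ ()))
⊨-∀* A (suc n) φ = mk⇔ (λ h ρ → from (⊨-cong A φ (∷-η ρ)) (h (λ k → ρ (suc k)) (ρ zero)))
                                  (λ h ρ d → h (d ∷ᵛ ρ)) ⇔-∘ ⊨-∀* A n (∀ᶠ φ)

⊨-∃* : ∀ (A : Str F G) n (φ : Formula F G n) → (A ⊨ˢ ∃* n φ) ⇔ Σ (Vector (Carrier A) n) λ ρ → A ⊨ φ [ ρ ]
⊨-∃* A zero φ = mk⇔ (λ h → (λ ()) , h) (λ (ρ , h) → from (⊨-cong A φ (λ ())) h)
⊨-∃* A (suc n) φ = mk⇔ (λ (ρ , d , h) → d ∷ᵛ ρ , h) (λ (ρ , h) → (λ k → ρ (suc k)) , ρ zero , to (⊨-cong A φ (∷-η ρ)) h) ⇔-∘ ⊨-∃* A n (∃ᶠ φ)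

-- The amalgam

record Decomposition {B C : Str F G} (i : Emb C B) : Set₁ where
  field
    Rest           : Set
    rest           : Rest → Carrier B
    rest-injective : ∀ {n n′} → rest n ≡ rest n′ → n ≡ n′
    rest-∉-image   : ∀ n c → rest n ≢ map i c
    cover          : ∀ b → InImage i b ⊎ Σ Rest λ n → rest n ≡ b

module Amalgam (P : Subset 5) {A B C : Str F G} (iA : Emb C A) (iB : Emb C B)
  (B-split : Decomposition iB) (kA : InK P A) (kB : InK P B) where

  open Decomposition B-split

  TransP : Set
  TransP = transitive ∈ˢ P

  R-trans : {X : Str F G} → InK P X → TransP → ∀ {x y z} → R X x y → R X y z → R X x z
  R-trans kX t = proj₁ kX transitive t

  R-A→B : ∀ {c c′} → R A (map iA c) (map iA c′) → R B (map iB c) (map iB c′)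
  R-A→B r = R-preserve iB (R-reflect iA r)

  R-B→A : ∀ {c c′} → R B (map iB c) (map iB c′) → R A (map iA c) (map iA c′)
  R-B→A r = R-preserve iA (R-reflect iB r)

  _≤ᴬ_ : Carrier A → Carrier A → Set
  x ≤ᴬ y = x ≡ y ⊎ TransP × R A x y

  ≤ᴬ-trans : ∀ {x y z} → x ≤ᴬ y → y ≤ᴬ z → x ≤ᴬ z
  ≤ᴬ-trans (inj₁ refl) l = l
  ≤ᴬ-trans (inj₂ r) (inj₁ refl) = inj₂ r
  ≤ᴬ-trans (inj₂ (t , r)) (inj₂ (_ , r′)) = inj₂ (t , R-trans kA t r r′)

  ≤ᴬ-R : ∀ {x y z} → x ≤ᴬ y → R A y z → R A x z
  ≤ᴬ-R (inj₁ refl) r = r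
  ≤ᴬ-R (inj₂ (t , r)) r′ = R-trans kA t r r′

  R-≤ᴬ : ∀ {x y z} → R A x y → y ≤ᴬ z → R A x z
  R-≤ᴬ r (inj₁ refl) = r
  R-≤ᴬ r (inj₂ (t , r′)) = R-trans kA t r r′

  Link : Carrier A → Carrier B → Set
  Link a b = Σ (Carrier C) λ c → a ≤ᴬ map iA c × R B (map iB c) b

  Link⁻ : Carrier B → Carrier A → Set
  Link⁻ b a = Σ (Carrier C) λ c → R B b (map iB c) × map iA c ≤ᴬ a

  Carrierᴰ : Set
  Carrierᴰ = Carrier A ⊎ Rest

  Rᴰ : Carrierᴰ → Carrierᴰ → Set
  Rᴰ (inj₁ a) (inj₁ a′) = R A a a′
  Rᴰ (inj₁ a) (inj₂ n)  = Link a (rest n)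
  Rᴰ (inj₂ n) (inj₁ a)  = Link⁻ (rest n) a
  Rᴰ (inj₂ n) (inj₂ n′) = R B (rest n) (rest n′)

  place : ∀ {b} → InImage iB b ⊎ Σ Rest (λ n → rest n ≡ b) → Carrierᴰ
  place (inj₁ (c , _)) = inj₁ (map iA c)
  place (inj₂ (n , _)) = inj₂ n

  toD : Carrier B → Carrierᴰ
  toD b = place (cover b)

  glue-op : (Carrier A → Carrier A) → (Carrier B → Carrier B) → Carrierᴰ → Carrierᴰ
  glue-op hA hB (inj₁ a) = inj₁ (hA a)
  glue-op hA hB (inj₂ n) = toD (hB (rest n))

  D : Str F G
  D = record
    { Carrier = Carrierᴰ
    ; R = Rᴰ
    ; f = λ i → glue-op (f A i) (f B i)
    ; g = λ j → glue-op (g A j) (g B j)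
    }

  data View : Carrier B → Carrierᴰ → Set where
    old : ∀ c → View (map iB c) (inj₁ (map iA c))
    new : ∀ n → View (rest n) (inj₂ n)

  view-place : ∀ {b} (s : InImage iB b ⊎ Σ Rest (λ n → rest n ≡ b)) → View b (place s)
  view-place (inj₁ (c , refl)) = old c
  view-place (inj₂ (n , refl)) = new n

  view : ∀ b → View b (toD b)
  view b = view-place (cover b)

  toD-image : ∀ c → toD (map iB c) ≡ inj₁ (map iA c)
  toD-image c = place-image (cover (map iB c))
    where
    place-image : (s : InImage iB (map iB c) ⊎ Σ Rest (λ n → rest n ≡ map iB c)) → place s ≡ inj₁ (map iA c)
    place-image (inj₁ (c′ , e)) = cong (λ x → inj₁ (map iA x)) (inj iB e)
    place-image (inj₂ (n , e)) = ⊥-elim (rest-∉-image n c e)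

  Link→Rᴰ : ∀ a b → Link a b → Rᴰ (inj₁ a) (toD b)
  Link→Rᴰ a b l with toD b | view b | l
  ... | _ | old c₀ | c , a≤c , r = ≤ᴬ-R a≤c (R-B→A r)
  ... | _ | new n  | l′ = l′

  Link⁻→Rᴰ : ∀ b a → Link⁻ b a → Rᴰ (toD b) (inj₁ a)
  Link⁻→Rᴰ b a l with toD b | view b | l
  ... | _ | old c₀ | c , r , c≤a = R-≤ᴬ (R-B→A r) c≤a
  ... | _ | new n  | l′ = l′

  toD-rel : ∀ b b′ → R B b b′ ⇔ Rᴰ (toD b) (toD b′)
  toD-rel b b′ with toD b | view b | toD b′ | view b′
  ... | _ | old c | _ | old c′ = mk⇔ R-B→A R-A→B
  ... | _ | old c | _ | new n  = mk⇔ (λ r → c , inj₁ refl , r) back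
    where
    back : Link (map iA c) (rest n) → R B (map iB c) (rest n)
    back (c″ , inj₁ e , r) rewrite inj iA e = r
    back (c″ , inj₂ (t , r′) , r) = R-trans kB t (R-A→B r′) r
  ... | _ | new n | _ | old c  = mk⇔ (λ r → c , r , inj₁ refl) back
    where
    back : Link⁻ (rest n) (map iA c) → R B (rest n) (map iB c)
    back (c″ , r , inj₁ e) rewrite inj iA e = r
    back (c″ , r , inj₂ (t , r′)) = R-trans kB t r (R-A→B r′)
  ... | _ | new n | _ | new n′ = ⇔-refl

  toD-injective : ∀ {b b′} → toD b ≡ toD b′ → b ≡ b′
  toD-injective {b} {b′} e with toD b | view b | toD b′ | view b′
  ... | _ | old c | _ | old c′ = cong (map iB) (inj iA (inj₁-injective e))
  ... | _ | new n | _ | new n′ = cong rest (inj₂-injective e)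
  ... | _ | old c | _ | new n  with () ← e
  ... | _ | new n | _ | old c  with () ← e

  eA : Emb A D
  eA = record { map = inj₁ ; inj = inj₁-injective ; rel-iff = λ _ _ → ⇔-refl
              ; f-hom = λ _ _ → refl ; g-hom = λ _ _ → refl }

  ≤ᴬ-monotone : ∀ {h : Carrier A → Carrier A} → (∀ {x y} → R A x y → R A (h x) (h y)) →
    ∀ {x y} → x ≤ᴬ y → h x ≤ᴬ h y
  ≤ᴬ-monotone mono (inj₁ refl) = inj₁ refl
  ≤ᴬ-monotone mono (inj₂ (t , r)) = inj₂ (t , mono r)

  ≤ᴬ-antitone : ∀ {h : Carrier A → Carrier A} → (∀ {x y} → R A x y → R A (h y) (h x)) →
    ∀ {x y} → x ≤ᴬ y → h y ≤ᴬ h x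
  ≤ᴬ-antitone anti (inj₁ refl) = inj₁ refl
  ≤ᴬ-antitone anti (inj₂ (t , r)) = inj₂ (t , anti r)

  module GluedOperation {hC : Carrier C → Carrier C} {hA : Carrier A → Carrier A} {hB : Carrier B → Carrier B}
    (homA : ∀ c → map iA (hC c) ≡ hA (map iA c)) (homB : ∀ c → map iB (hC c) ≡ hB (map iB c)) where

    toD-hom : ∀ b → toD (hB b) ≡ glue-op hA hB (toD b)
    toD-hom b with toD b | view b
    ... | _ | old c = trans (cong toD (sym (homB c))) (trans (toD-image (hC c)) (cong inj₁ (homA c)))
    ... | _ | new n = refl

    glue-op-monotone : (∀ {x y} → R A x y → R A (hA x) (hA y)) → (∀ {x y} → R B x y → R B (hB x) (hB y)) →
      ∀ x y → Rᴰ x y → Rᴰ (glue-op hA hB x) (glue-op hA hB y)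
    glue-op-monotone monoA monoB (inj₁ a) (inj₁ a′) r = monoA r
    glue-op-monotone monoA monoB (inj₁ a) (inj₂ n) (c , a≤c , r) =
      Link→Rᴰ _ _ (hC c , subst (hA a ≤ᴬ_) (sym (homA c)) (≤ᴬ-monotone monoA a≤c)
                        , subst (λ z → R B z _) (sym (homB c)) (monoB r))
    glue-op-monotone monoA monoB (inj₂ n) (inj₁ a) (c , r , c≤a) =
      Link⁻→Rᴰ _ _ (hC c , subst (R B _) (sym (homB c)) (monoB r)
                         , subst (_≤ᴬ hA a) (sym (homA c)) (≤ᴬ-monotone monoA c≤a))
    glue-op-monotone monoA monoB (inj₂ n) (inj₂ n′) r = to (toD-rel _ _) (monoB r)

    glue-op-antitone : (∀ {x y} → R A x y → R A (hA y) (hA x)) → (∀ {x y} → R B x y → R B (hB y) (hB x)) →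
      ∀ x y → Rᴰ x y → Rᴰ (glue-op hA hB y) (glue-op hA hB x)
    glue-op-antitone antiA antiB (inj₁ a) (inj₁ a′) r = antiA r
    glue-op-antitone antiA antiB (inj₁ a) (inj₂ n) (c , a≤c , r) =
      Link⁻→Rᴰ _ _ (hC c , subst (R B _) (sym (homB c)) (antiB r)
                         , subst (_≤ᴬ hA a) (sym (homA c)) (≤ᴬ-antitone antiA a≤c))
    glue-op-antitone antiA antiB (inj₂ n) (inj₁ a) (c , r , c≤a) =
      Link→Rᴰ _ _ (hC c , subst (hA a ≤ᴬ_) (sym (homA c)) (≤ᴬ-antitone antiA c≤a)
                        , subst (λ z → R B z _) (sym (homB c)) (antiB r))
    glue-op-antitone antiA antiB (inj₂ n) (inj₂ n′) r = to (toD-rel _ _) (antiB r)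

  module Gluedᶠ (i : F) = GluedOperation {hC = f C i} {f A i} {f B i} (f-hom iA i) (f-hom iB i)
  module Gluedᵍ (j : G) = GluedOperation {hC = g C j} {g A j} {g B j} (g-hom iA j) (g-hom iB j)

  eB : Emb B D
  eB = record
    { map = toD
    ; inj = toD-injective
    ; rel-iff = toD-rel
    ; f-hom = λ i → Gluedᶠ.toD-hom i
    ; g-hom = λ j → Gluedᵍ.toD-hom j
    }

  commute : ∀ c → map eA (map iA c) ≡ map eB (map iB c)
  commute c = sym (toD-image c)

  glued-only-along-C : ∀ a b → map eA a ≡ map eB b →
    Σ (Carrier C) λ c → (map iA c ≡ a) × (map iB c ≡ b)
  glued-only-along-C a b e with toD b | view b
  ... | _ | old c = c , sym (inj₁-injective e) , refl
  ... | _ | new n with () ← e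

  related-through-C : ∀ a b → ¬ InImage iA a → ¬ InImage iB b → Rᴰ (map eA a) (map eB b) →
    Σ (Carrier C) λ c → R A a (map iA c) × R B (map iB c) b
  related-through-C a b a∉ b∉ r with toD b | view b | r
  ... | _ | old c | _ = ⊥-elim (b∉ (c , refl))
  ... | _ | new n | c , inj₁ e , r′ = ⊥-elim (a∉ (c , sym e))
  ... | _ | new n | c , inj₂ (_ , r″) , r′ = c , r″ , r′

  related-through-C⁻ : ∀ a b → ¬ InImage iA a → ¬ InImage iB b → Rᴰ (map eB b) (map eA a) →
    Σ (Carrier C) λ c → R B b (map iB c) × R A (map iA c) a
  related-through-C⁻ a b a∉ b∉ r with toD b | view b | r
  ... | _ | old c | _ = ⊥-elim (b∉ (c , refl))
  ... | _ | new n | c , r′ , inj₁ e = ⊥-elim (a∉ (c , e))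
  ... | _ | new n | c , r′ , inj₂ (_ , r″) = c , r′ , r″

  Rᴰ-trans : TransP → ∀ {x y z} → Rᴰ x y → Rᴰ y z → Rᴰ x z
  Rᴰ-trans t {inj₁ a} {inj₁ a′} {inj₁ a″} r r′ = R-trans kA t r r′
  Rᴰ-trans t {inj₁ a} {inj₁ a′} {inj₂ n} r (c , a′≤c , r′) = c , inj₂ (t , R-≤ᴬ r a′≤c) , r′
  Rᴰ-trans t {inj₁ a} {inj₂ n} {inj₁ a″} (c , a≤c , r) (c′ , r′ , c′≤a″) =
    ≤ᴬ-R a≤c (R-≤ᴬ (R-B→A (R-trans kB t r r′)) c′≤a″)
  Rᴰ-trans t {inj₁ a} {inj₂ n} {inj₂ n″} (c , a≤c , r) r′ = c , a≤c , R-trans kB t r r′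
  Rᴰ-trans t {inj₂ n} {inj₁ a′} {inj₁ a″} (c , r , c≤a′) r′ = c , r , inj₂ (t , ≤ᴬ-R c≤a′ r′)
  Rᴰ-trans t {inj₂ n} {inj₁ a′} {inj₂ n″} (c , r , c≤a′) (c′ , a′≤c′ , r′)
    with ≤ᴬ-trans c≤a′ a′≤c′
  ... | inj₁ e rewrite inj iA e = R-trans kB t r r′
  ... | inj₂ (_ , r″) = R-trans kB t r (R-trans kB t (R-A→B r″) r′)
  Rᴰ-trans t {inj₂ n} {inj₂ n′} {inj₁ a″} r (c , r′ , c≤a″) = c , R-trans kB t r r′ , c≤a″
  Rᴰ-trans t {inj₂ n} {inj₂ n′} {inj₂ n″} r r′ = R-trans kB t r r′

  ≤ᴬ-sym : symmetric ∈ˢ P → ∀ {x y} → x ≤ᴬ y → y ≤ᴬ x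
  ≤ᴬ-sym p (inj₁ e) = inj₁ (sym e)
  ≤ᴬ-sym p (inj₂ (t , r)) = inj₂ (t , proj₁ kA symmetric p r)

  Rᴰ-sym : symmetric ∈ˢ P → ∀ {x y} → Rᴰ x y → Rᴰ y x
  Rᴰ-sym p {inj₁ a} {inj₁ a′} r = proj₁ kA symmetric p r
  Rᴰ-sym p {inj₁ a} {inj₂ n} (c , a≤c , r) = c , proj₁ kB symmetric p r , ≤ᴬ-sym p a≤c
  Rᴰ-sym p {inj₂ n} {inj₁ a} (c , r , c≤a) = c , ≤ᴬ-sym p c≤a , proj₁ kB symmetric p r
  Rᴰ-sym p {inj₂ n} {inj₂ n′} r = proj₁ kB symmetric p r

  Links-contradict-antisymmetry : antisymmetric ∈ˢ P → ∀ a n → Link a (rest n) → Link⁻ (rest n) a → ⊥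
  Links-contradict-antisymmetry p a n (c , a≤c , r) (c′ , r′ , c′≤a) =
    rest-∉-image n c (sym (proj₁ kB antisymmetric p r r″))
    where
    c′≡c : c′ ≡ c
    c′≡c with ≤ᴬ-trans c′≤a a≤c
    ... | inj₁ e = inj iA e
    ... | inj₂ (t , r‴) = inj iA (proj₁ kA antisymmetric p r‴ (R-B→A (R-trans kB t r r′)))
    r″ : R B (rest n) (map iB c)
    r″ = subst (λ z → R B (rest n) (map iB z)) c′≡c r′

  Rᴰ-antisym : antisymmetric ∈ˢ P → ∀ {x y} → Rᴰ x y → Rᴰ y x → x ≡ y
  Rᴰ-antisym p {inj₁ a} {inj₁ a′} r r′ = cong inj₁ (proj₁ kA antisymmetric p r r′)
  Rᴰ-antisym p {inj₁ a} {inj₂ n} r r′ = ⊥-elim (Links-contradict-antisymmetry p a n r r′)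
  Rᴰ-antisym p {inj₂ n} {inj₁ a} r r′ = ⊥-elim (Links-contradict-antisymmetry p a n r′ r)
  Rᴰ-antisym p {inj₂ n} {inj₂ n′} r r′ = cong inj₂ (rest-injective (proj₁ kB antisymmetric p r r′))

  D-InKP : InKP P D
  D-InKP transitive p {x} {y} {z} = Rᴰ-trans p {x} {y} {z}
  D-InKP reflexive p (inj₁ a) = proj₁ kA reflexive p a
  D-InKP reflexive p (inj₂ n) = proj₁ kB reflexive p (rest n)
  D-InKP symmetric p {x} {y} = Rᴰ-sym p {x} {y}
  D-InKP antireflexive p (inj₁ a) = proj₁ kA antireflexive p a
  D-InKP antireflexive p (inj₂ n) = proj₁ kB antireflexive p (rest n)
  D-InKP antisymmetric p {x} {y} = Rᴰ-antisym p {x} {y}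

  D-InK : InK P D
  D-InK = D-InKP
        , (λ i → Gluedᶠ.glue-op-monotone i (proj₁ (proj₂ kA) i _ _) (proj₁ (proj₂ kB) i _ _))
        , (λ j → Gluedᵍ.glue-op-antitone j (proj₂ (proj₂ kA) j _ _) (proj₂ (proj₂ kB) j _ _))

-- Cantor's enumeration of ℕ × ℕ along the anti-diagonals
next-pair : ℕ × ℕ → ℕ × ℕ
next-pair (a , zero) = 0 , suc a
next-pair (a , suc b) = suc a , b

unpair : ℕ → ℕ × ℕ
unpair zero = 0 , 0
unpair (suc n) = next-pair (unpair n)

unpair-surjective : ∀ s a b → a + b ≡ s → Σ ℕ λ n → unpair n ≡ (a , b)
unpair-surjective _ zero zero _ = 0 , refl
unpair-surjective (suc s) zero (suc b) e
  with n , p ← unpair-surjective s b zero (trans (+-identityʳ b) (suc-injective e))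
  = suc n , cong next-pair p
unpair-surjective s (suc a) b e
  with n , p ← unpair-surjective s a (suc b) (trans (+-suc a b) e)
  = suc n , cong next-pair p

pair : ℕ → ℕ → ℕ
pair a b = proj₁ (unpair-surjective (a + b) a b refl)

pair-injective : ∀ {a b a′ b′} → pair a b ≡ pair a′ b′ → a ≡ a′ × b ≡ b′
pair-injective {a} {b} {a′} {b′} e
  with refl ← trans (sym (proj₂ (unpair-surjective (a + b) a b refl)))
                    (trans (cong unpair e) (proj₂ (unpair-surjective (a′ + b′) a′ b′ refl)))
  = refl , refl

upper-bound : ∀ n (v : Fin n → ℕ) → Σ ℕ λ m → ∀ i → v i ≤ m
upper-bound zero v = 0 , λ ()
upper-bound (suc n) v = v zero + m , bounded
  where
  m = proj₁ (upper-bound n (λ i → v (suc i)))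
  bounded : ∀ i → v i ≤ v zero + m
  bounded zero = m≤m+n _ _
  bounded (suc i) = ≤-trans (proj₂ (upper-bound n (λ i → v (suc i))) i) (m≤n+m _ _)

finite-upper-bound : ∀ {n} {X : Set} → X ↔ Fin n → (v : X → ℕ) → Σ ℕ λ m → ∀ x → v x ≤ m
finite-upper-bound {n} φ v =
  proj₁ B , λ x → subst (λ z → v z ≤ proj₁ B) (strictlyInverseʳ φ x) (proj₂ B (to φ x))
  where
  B = upper-bound n (λ i → v (from φ i))

↔-injective : {X Y : Set} (φ : X ↔ Y) → ∀ {x y} → to φ x ≡ to φ y → x ≡ y
↔-injective φ = Injection.injective (Inverse⇒Injection φ)

⊎-finite : ∀ {n m} {X Y : Set} → X ↔ Fin n → Y ↔ Fin m → (X ⊎ Y) ↔ Fin (n + m)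
⊎-finite φ ψ = ↔-trans (φ ⊎-↔ ψ) (↔-sym +↔⊎)

table : ∀ {X : Set} {m n} → (Fin m → Fin n → X) → Vec (Vec X n) m
table h = Vec.tabulate (λ i → Vec.tabulate (h i))

lookup-table : ∀ {X : Set} {m n} (h : Fin m → Fin n → X) i j → Vec.lookup (Vec.lookup (table h) i) j ≡ h i j
lookup-table h i j rewrite lookup∘tabulate (λ i → Vec.tabulate (h i)) i = lookup∘tabulate (h i) j

Exhaustive : {X : Set} → List X → Set
Exhaustive xs = ∀ x → x ∈ xs

finite-exhaustive : ∀ {n} {X : Set} → X ↔ Fin n → Σ (List X) Exhaustive
finite-exhaustive {n} φ = List.map (from φ) (allFin n) , λ x →
  subst (_∈ List.map (from φ) (allFin n)) (strictlyInverseʳ φ x) (∈-map⁺ (from φ) (∈-allFin (to φ x)))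

vectors : {X : Set} → List X → ∀ n → List (Vec X n)
vectors xs zero = [] ∷ []
vectors xs (suc n) = cartesianProductWith _∷_ xs (vectors xs n)

vectors-exhaustive : {X : Set} {xs : List X} → Exhaustive xs → ∀ n → Exhaustive (vectors xs n)
vectors-exhaustive all zero [] = here refl
vectors-exhaustive all (suc n) (x ∷ v) = ∈-cartesianProductWith⁺ _∷_ (all x) (vectors-exhaustive all n v)

cartesianProduct-exhaustive : {X Y : Set} {xs : List X} {ys : List Y} →
  Exhaustive xs → Exhaustive ys → Exhaustive (cartesianProduct xs ys)
cartesianProduct-exhaustive all-x all-y (x , y) = ∈-cartesianProduct⁺ (all-x x) (all-y y)

booleans : List Bool
booleans = true ∷ false ∷ []

booleans-exhaustive : Exhaustive booleans
booleans-exhaustive true = here refl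
booleans-exhaustive false = there (here refl)

-- Atomic types of tuples in relational structures

RelStr : Set₁
RelStr = Str ⊥ ⊥

record SameAtomicType (A : RelStr) {n : ℕ} (ρ : Vector (Carrier A) n) (B : RelStr) (ρ′ : Vector (Carrier B) n) : Set where
  constructor same-type
  field
    same-at : ∀ i j → (ρ i ≡ ρ j ⇔ ρ′ i ≡ ρ′ j) × (R A (ρ i) (ρ j) ⇔ R B (ρ′ i) (ρ′ j))
open SameAtomicType

module _ {A B : RelStr} {n : ℕ} where

  same-type-sym : {ρ : Vector (Carrier A) n} {ρ′ : Vector (Carrier B) n} →
    SameAtomicType A ρ B ρ′ → SameAtomicType B ρ′ A ρ
  same-type-sym (same-type t) = same-type λ i j → ⇔-sym (proj₁ (t i j)) , ⇔-sym (proj₂ (t i j))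

  same-type-trans : {C : RelStr} {ρ : Vector (Carrier A) n} {ρ′ : Vector (Carrier B) n} {ρ″ : Vector (Carrier C) n} →
    SameAtomicType A ρ B ρ′ → SameAtomicType B ρ′ C ρ″ → SameAtomicType A ρ C ρ″
  same-type-trans (same-type t) (same-type t′) =
    same-type λ i j → proj₁ (t′ i j) ⇔-∘ proj₁ (t i j) , proj₂ (t′ i j) ⇔-∘ proj₂ (t i j)

  same-type-cong : {ρ₁ ρ₂ : Vector (Carrier A) n} {ρ₁′ ρ₂′ : Vector (Carrier B) n} →
    (∀ i → ρ₁ i ≡ ρ₂ i) → (∀ i → ρ₁′ i ≡ ρ₂′ i) → SameAtomicType A ρ₁ B ρ₁′ → SameAtomicType A ρ₂ B ρ₂′
  same-type-cong e e′ (same-type t) = same-type λ i j →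
    ≡-cong-⇔ (e′ i) (e′ j) ⇔-∘ (proj₁ (t i j) ⇔-∘ ≡-cong-⇔ (sym (e i)) (sym (e j))) ,
    R-cong B (e′ i) (e′ j) ⇔-∘ (proj₂ (t i j) ⇔-∘ R-cong A (sym (e i)) (sym (e j)))

same-type-tail : {A B : RelStr} {n : ℕ} {x : Carrier A} {y : Carrier B} {ρ : Vector (Carrier A) n} {ρ′ : Vector (Carrier B) n} →
  SameAtomicType A (x ∷ᵛ ρ) B (y ∷ᵛ ρ′) → SameAtomicType A ρ B ρ′
same-type-tail (same-type t) = same-type λ i j → t (suc i) (suc j)

-- entry i j of a code records whether ρ i ≡ ρ j and whether R (ρ i) (ρ j)
DiagramCode : ℕ → Set
DiagramCode n = Vec (Vec (Bool × Bool) n) n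

entry : ∀ {n} → DiagramCode n → Fin n → Fin n → Bool × Bool
entry δ i j = Vec.lookup (Vec.lookup δ i) j

Signed : Bool → Set → Set
Signed true X = X
Signed false X = ¬ X

signed : ∀ {n} → Bool → Formula ⊥ ⊥ n → Formula ⊥ ⊥ n
signed true φ = φ
signed false φ = φ ⇒ ⊥ᶠ

⊨-signed : ∀ {n} {A : RelStr} b (φ : Formula ⊥ ⊥ n) ρ → (A ⊨ signed b φ [ ρ ]) ⇔ Signed b (A ⊨ φ [ ρ ])
⊨-signed true φ ρ = ⇔-refl
⊨-signed false φ ρ = ⇔-refl

signed-QF : ∀ {n} b {φ : Formula ⊥ ⊥ n} → QF φ → QF (signed b φ)
signed-QF true q = q
signed-QF false q = qf-⇒ q qf-⊥

Signed-⇔ : ∀ {X Y : Set} b → Signed b X → Signed b Y → X ⇔ Y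
Signed-⇔ true x y = mk⇔ (λ _ → y) (λ _ → x)
Signed-⇔ false ¬x ¬y = mk⇔ (λ x → ⊥-elim (¬x x)) (λ y → ⊥-elim (¬y y))

Signed-transport : ∀ {X Y : Set} b → X ⇔ Y → Signed b X → Signed b Y
Signed-transport true e x = to e x
Signed-transport false e ¬x y = ¬x (from e y)

literal : ∀ {n} → DiagramCode n → Fin n → Fin n → Formula ⊥ ⊥ n
literal δ i j = signed (proj₁ (entry δ i j)) (var i ≐ var j) ∧ᶠ signed (proj₂ (entry δ i j)) (rel (var i) (var j))

diagram : ∀ {n} → DiagramCode n → Formula ⊥ ⊥ n
diagram {n} δ = ⋀ n λ i → ⋀ n (literal δ i)

diagram-QF : ∀ {n} (δ : DiagramCode n) → QF (diagram δ)
diagram-QF {n} δ = ⋀-QF n _ λ i → ⋀-QF n _ λ j →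
  qf-∧ (signed-QF (proj₁ (entry δ i j)) (qf-≐ _ _)) (signed-QF (proj₂ (entry δ i j)) (qf-R _ _))

record Realizes (A : RelStr) {n : ℕ} (ρ : Vector (Carrier A) n) (δ : DiagramCode n) : Set where
  constructor realizes
  field
    realizes-at : ∀ i j → Signed (proj₁ (entry δ i j)) (ρ i ≡ ρ j) × Signed (proj₂ (entry δ i j)) (R A (ρ i) (ρ j))
open Realizes

⊨-diagram : ∀ (A : RelStr) {n} (δ : DiagramCode n) ρ → (A ⊨ diagram δ [ ρ ]) ⇔ Realizes A ρ δ
⊨-diagram A {n} δ ρ =
  mk⇔ realizes realizes-at ⇔-∘ (Π-⇔ (λ i → Π-⇔ (λ j → literals i j) ⇔-∘ ⊨-⋀ A n (literal δ i) ρ) ⇔-∘ ⊨-⋀ A n (λ i → ⋀ n (literal δ i)) ρ)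
  where
  literals : ∀ i j → (A ⊨ literal δ i j [ ρ ]) ⇔ _
  literals i j = ⊨-signed {A = A} (proj₁ (entry δ i j)) (var i ≐ var j) ρ ×-⇔ ⊨-signed {A = A} (proj₂ (entry δ i j)) (rel (var i) (var j)) ρ

realizers-same-type : ∀ {A B : RelStr} {n} {ρ ρ′} (δ : DiagramCode n) →
  Realizes A ρ δ → Realizes B ρ′ δ → SameAtomicType A ρ B ρ′
realizers-same-type δ (realizes r) (realizes r′) = same-type λ i j →
  Signed-⇔ (proj₁ (entry δ i j)) (proj₁ (r i j)) (proj₁ (r′ i j)) ,
  Signed-⇔ (proj₂ (entry δ i j)) (proj₂ (r i j)) (proj₂ (r′ i j))

same-type-realizes : ∀ {A B : RelStr} {n} {ρ ρ′} (δ : DiagramCode n) →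
  SameAtomicType A ρ B ρ′ → Realizes A ρ δ → Realizes B ρ′ δ
same-type-realizes δ (same-type t) (realizes r) = realizes λ i j →
  Signed-transport (proj₁ (entry δ i j)) (proj₁ (t i j)) (proj₁ (r i j)) ,
  Signed-transport (proj₂ (entry δ i j)) (proj₂ (t i j)) (proj₂ (r i j))

all-diagrams : ∀ n → List (DiagramCode n)
all-diagrams n = vectors (vectors (cartesianProduct booleans booleans) n) n

all-diagrams-exhaustive : ∀ n → Exhaustive (all-diagrams n)
all-diagrams-exhaustive n =
  vectors-exhaustive (vectors-exhaustive (cartesianProduct-exhaustive booleans-exhaustive booleans-exhaustive) n) n

⋁-diagrams : ∀ {n} → List (DiagramCode n) → Formula ⊥ ⊥ n
⋁-diagrams [] = ⊥ᶠ
⋁-diagrams (δ ∷ δs) = diagram δ ∨ᶠ ⋁-diagrams δs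

⋁-diagrams-QF : ∀ {n} (δs : List (DiagramCode n)) → QF (⋁-diagrams δs)
⋁-diagrams-QF [] = qf-⊥
⋁-diagrams-QF (δ ∷ δs) = qf-∨ (diagram-QF δ) (⋁-diagrams-QF δs)

⊨-⋁-diagrams : ∀ (A : RelStr) {n} (δs : List (DiagramCode n)) ρ →
  (A ⊨ ⋁-diagrams δs [ ρ ]) ⇔ Σ (DiagramCode n) λ δ → δ ∈ δs × Realizes A ρ δ
⊨-⋁-diagrams A [] ρ = mk⇔ (λ ()) (λ { (_ , () , _) })
⊨-⋁-diagrams A (δ ∷ δs) ρ = mk⇔
  (λ { (inj₁ h) → δ , here refl , to (⊨-diagram A δ ρ) h
     ; (inj₂ h) → let δ′ , q , r = to (⊨-⋁-diagrams A δs ρ) h in δ′ , there q , r })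
  (λ { (_ , here refl , r) → inj₁ (from (⊨-diagram A δ ρ) r)
     ; (δ′ , there q , r) → inj₂ (from (⊨-⋁-diagrams A δs ρ) (δ′ , q , r)) })

-- Back and forth

Coherent : (A B : Str F G) → Carrier A → Carrier B → Carrier A → Carrier B → Set
Coherent A B x y x′ y′ =
  (x ≡ x′ → y ≡ y′) × (y ≡ y′ → x ≡ x′) × (R A x x′ ⇔ R B y y′)
  × (∀ i → f A i x ≡ x′ → f B i y ≡ y′) × (∀ j → g A j x ≡ x′ → g B j y ≡ y′)

module BackAndForth {ℓ} (A B : Str F G)
  (enumA : ℕ → Maybe (Carrier A)) (enumA-onto : ∀ x → Σ ℕ λ n → enumA n ≡ just x)
  (enumB : ℕ → Maybe (Carrier B)) (enumB-onto : ∀ y → Σ ℕ λ n → enumB n ≡ just y)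
  (Good : List (Carrier A × Carrier B) → Set ℓ)
  (forth : ∀ l x → Good l → Σ (Carrier B) λ y → Good ((x , y) ∷ l))
  (back : ∀ l y → Good l → Σ (Carrier A) λ x → Good ((x , y) ∷ l))
  (coherent : ∀ {l} → Good l → ∀ {x y x′ y′} → (x , y) ∈ l → (x′ , y′) ∈ l → Coherent A B x y x′ y′)
  (l₀ : List (Carrier A × Carrier B)) (good₀ : Good l₀) where

  State : Set ℓ
  State = Σ (List (Carrier A × Carrier B)) Good

  forth-step : Maybe (Carrier A) → State → State
  forth-step nothing s = s
  forth-step (just x) (l , good) = let y , good′ = forth l x good in (x , y) ∷ l , good′

  back-step : Maybe (Carrier B) → State → State
  back-step nothing s = s
  back-step (just y) (l , good) = let x , good′ = back l y good in (x , y) ∷ l , good′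

  state : ℕ → State
  state zero = l₀ , good₀
  state (suc n) = back-step (enumB n) (forth-step (enumA n) (state n))

  pairs : ℕ → List (Carrier A × Carrier B)
  pairs n = proj₁ (state n)

  forth-step-grows : ∀ m s {p} → p ∈ proj₁ s → p ∈ proj₁ (forth-step m s)
  forth-step-grows nothing s q = q
  forth-step-grows (just x) s q = there q

  back-step-grows : ∀ m s {p} → p ∈ proj₁ s → p ∈ proj₁ (back-step m s)
  back-step-grows nothing s q = q
  back-step-grows (just y) s q = there q

  pairs-grow′ : ∀ {n m} → n ≤′ m → ∀ {p} → p ∈ pairs n → p ∈ pairs m
  pairs-grow′ ≤′-refl q = q
  pairs-grow′ (≤′-step le) q = back-step-grows (enumB _) _ (forth-step-grows (enumA _) _ (pairs-grow′ le q))

  pairs-coherent : ∀ n m {x y x′ y′} → (x , y) ∈ pairs n → (x′ , y′) ∈ pairs m → Coherent A B x y x′ y′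
  pairs-coherent n m q q′ =
    coherent (proj₂ (state (n + m))) (pairs-grow′ (≤⇒≤′ (m≤m+n n m)) q) (pairs-grow′ (≤⇒≤′ (m≤n+m m n)) q′)

  stage : Carrier A → ℕ
  stage x = proj₁ (enumA-onto x)

  σ : Carrier A → Carrier B
  σ x = proj₁ (forth (pairs (stage x)) x (proj₂ (state (stage x))))

  σ-recorded : ∀ x → (x , σ x) ∈ pairs (suc (stage x))
  σ-recorded x with enumA (stage x) | proj₂ (enumA-onto x)
  ... | .(just x) | refl = back-step-grows (enumB (stage x)) _ (here refl)

  σ-coherent : ∀ x x′ → Coherent A B x (σ x) x′ (σ x′)
  σ-coherent x x′ = pairs-coherent (suc (stage x)) (suc (stage x′)) (σ-recorded x) (σ-recorded x′)

  σ-surjective : ∀ y → Σ (Carrier A) λ x → σ x ≡ y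
  σ-surjective y = x , proj₁ (pairs-coherent (suc (stage x)) (suc n) (σ-recorded x) y-recorded) refl
    where
    n = proj₁ (enumB-onto y)
    x = proj₁ (back (proj₁ (forth-step (enumA n) (state n))) y (proj₂ (forth-step (enumA n) (state n))))
    y-recorded : (x , y) ∈ pairs (suc n)
    y-recorded with enumB n | proj₂ (enumB-onto y)
    ... | .(just y) | refl = here refl

  iso : Iso A B
  iso = record
    { map = σ
    ; inj = λ {x} {x′} → proj₁ (proj₂ (σ-coherent x x′))
    ; rel-iff = λ x x′ → proj₁ (proj₂ (proj₂ (σ-coherent x x′)))
    ; f-hom = λ i x → sym (proj₁ (proj₂ (proj₂ (proj₂ (σ-coherent x (f A i x))))) i refl)
    ; g-hom = λ j x → sym (proj₂ (proj₂ (proj₂ (proj₂ (σ-coherent x (g A j x))))) j refl)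
    } , σ-surjective

  iso-extends : ∀ {x y} → (x , y) ∈ l₀ → σ x ≡ y
  iso-extends {x} q = sym (proj₁ (pairs-coherent zero (suc (stage x)) q (σ-recorded x)) refl)

module Classical (lem : ExcludedMiddle) where

  -- membership proofs of a Subtype are irrelevant, unlike those of Σ X P
  Subtype : {X : Set} → (X → Set) → Set
  Subtype {X} P = Σ X λ x → True (lem (P x))

  subtype-≡ : {X : Set} {P : X → Set} {s t : Subtype P} → proj₁ s ≡ proj₁ t → s ≡ t
  subtype-≡ {s = x , p} {t = .x , q} refl = cong (x ,_) (T-irrelevant p q)

  image-decomposition : {B C : Str F G} (i : Emb C B) → Decomposition i
  image-decomposition {B = B} i = record
    { Rest = Subtype (λ b → ¬ InImage i b)
    ; rest = proj₁
    ; rest-injective = subtype-≡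
    ; rest-∉-image = λ (b , p) c e → toWitness p (c , sym e)
    ; cover = λ b → cover b (lem (InImage i b))
    }
    where
    cover : ∀ b → Dec (InImage i b) → InImage i b ⊎ Σ (Subtype (λ b → ¬ InImage i b)) λ n → proj₁ n ≡ b
    cover b (yes p) = inj₁ p
    cover b (no ¬p) = inj₂ ((b , fromWitness ¬p) , refl)

  superSAP : (P : Subset 5) → SuperSAP (InK {F} {G} P)
  superSAP P A B C kA kB _ iA iB =
    D , D-InK , eA , eB , commute , glued-only-along-C , related-through-C , related-through-C⁻
    where open Amalgam P iA iB (image-decomposition iB) kA kB

  split-point : {X : Set} (x₀ : X) → X ↔ (⊤ ⊎ Subtype (λ x → x ≢ x₀))
  split-point {X} x₀ = mk↔ₛ′ to′ from′ to∘from from∘to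
    where
    classify : ∀ x → Dec (x ≡ x₀) → ⊤ ⊎ Subtype (λ x → x ≢ x₀)
    classify x (yes _) = inj₁ tt
    classify x (no x≢x₀) = inj₂ (x , fromWitness x≢x₀)
    to′ : X → ⊤ ⊎ Subtype (λ x → x ≢ x₀)
    to′ x = classify x (lem (x ≡ x₀))
    from′ : ⊤ ⊎ Subtype (λ x → x ≢ x₀) → X
    from′ (inj₁ _) = x₀
    from′ (inj₂ (x , _)) = x
    to∘from : ∀ s → to′ (from′ s) ≡ s
    to∘from (inj₁ tt) with lem (x₀ ≡ x₀)
    ... | yes _ = refl
    ... | no x₀≢x₀ = ⊥-elim (x₀≢x₀ refl)
    to∘from (inj₂ (x , p)) with lem (x ≡ x₀)
    ... | yes x≡x₀ = ⊥-elim (toWitness p x≡x₀)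
    ... | no _ = cong inj₂ (subtype-≡ refl)
    from∘to : ∀ x → from′ (to′ x) ≡ x
    from∘to x with lem (x ≡ x₀)
    ... | yes x≡x₀ = sym x≡x₀
    ... | no _ = refl

  injection-finite : ∀ n {X : Set} (h : X → Fin n) → (∀ {x y} → h x ≡ h y → x ≡ y) →
    Σ ℕ λ m → m ≤ n × (X ↔ Fin m)
  injection-finite zero h h-inj =
    0 , z≤n , mk↔ₛ′ (λ x → ⊥-elim (¬Fin0 (h x))) (λ ()) (λ ()) (λ x → ⊥-elim (¬Fin0 (h x)))
  injection-finite (suc n) {X} h h-inj with lem (Σ X λ x → h x ≡ zero)
  ... | no ¬hit =
    let m , m≤n , φ = injection-finite n (λ x → punchOut (avoid x)) (λ {x} {y} e → h-inj (punchOut-injective (avoid x) (avoid y) e))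
    in m , m≤n⇒m≤1+n m≤n , φ
    where
    avoid : ∀ x → zero ≢ h x
    avoid x e = ¬hit (x , sym e)
  ... | yes (x₀ , hx₀) =
    let m , m≤n , φ = injection-finite n (λ x → punchOut (avoid x)) (λ {x} {y} e → subtype-≡ (h-inj (punchOut-injective (avoid x) (avoid y) e)))
    in suc m , s≤s m≤n , ↔-trans (split-point x₀) (↔-trans (↔-refl ⊎-↔ φ) (↔-sym (↔-trans (+↔⊎ {1}) (1↔⊤ ⊎-↔ ↔-refl))))
    where
    avoid : ∀ (x : Subtype (λ x → x ≢ x₀)) → zero ≢ h (proj₁ x)
    avoid (x , p) e = toWitness p (h-inj (trans (sym e) (sym hx₀)))

  enumeration : {X : Set} (h : X → ℕ) → (∀ {x y} → h x ≡ h y → x ≡ y) →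
    Σ (ℕ → Maybe X) λ en → ∀ x → Σ ℕ λ n → en n ≡ just x
  enumeration {X} h h-inj = (λ n → pick n (lem (Σ X λ x → h x ≡ n))) , λ x → h x , pick-hit x _
    where
    pick : ∀ n → Dec (Σ X λ x → h x ≡ n) → Maybe X
    pick n (yes (x , _)) = just x
    pick n (no _) = nothing
    pick-hit : ∀ x d → pick (h x) d ≡ just x
    pick-hit x (yes (y , e)) = cong just (h-inj e)
    pick-hit x (no ¬p) = ⊥-elim (¬p (x , refl))

  -- Direct limits of chains

  module DirectLimit (M : ℕ → Str F G) (e : ∀ k → Emb (M k) (M (suc k))) where

    Fresh : ℕ → Set
    Fresh zero = Carrier (M zero)
    Fresh (suc k) = Subtype (λ y → ¬ InImage (e k) y)

    element : ∀ k → Fresh k → Carrier (M k)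
    element zero x = x
    element (suc k) (y , _) = y

    ι : ∀ k → Carrier (M k) → Σ ℕ Fresh
    ι-case : ∀ k (y : Carrier (M (suc k))) → Dec (InImage (e k) y) → Σ ℕ Fresh
    ι zero x = zero , x
    ι (suc k) y = ι-case k y (lem (InImage (e k) y))
    ι-case k y (yes (x , _)) = ι k x
    ι-case k y (no ¬p) = suc k , (y , fromWitness ¬p)

    ι-e : ∀ k x → ι (suc k) (map (e k) x) ≡ ι k x
    ι-e k x with lem (InImage (e k) (map (e k) x))
    ... | yes (x′ , q) = cong (ι k) (inj (e k) q)
    ... | no ¬p = ⊥-elim (¬p (x , refl))

    ι-element : ∀ k n → ι k (element k n) ≡ (k , n)
    ι-element zero n = refl
    ι-element (suc k) (y , p) with lem (InImage (e k) y)
    ... | yes q = ⊥-elim (toWitness p q)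
    ... | no _ = cong (suc k ,_) (subtype-≡ refl)

    ι-level : ∀ k x → proj₁ (ι k x) ≤ k
    ι-level zero x = z≤n
    ι-level (suc k) y with lem (InImage (e k) y)
    ... | yes (x , _) = m≤n⇒m≤1+n (ι-level k x)
    ... | no _ = ≤-refl

    ι-injective : ∀ k {x x′} → ι k x ≡ ι k x′ → x ≡ x′
    ι-injective zero refl = refl
    ι-injective (suc k) {x} {x′} q with lem (InImage (e k) x) | lem (InImage (e k) x′)
    ... | yes (z , refl) | yes (z′ , refl) = cong (map (e k)) (ι-injective k q)
    ... | yes (z , _) | no _ = ⊥-elim (1+n≰n (subst (_≤ k) (cong proj₁ q) (ι-level k z)))
    ... | no _ | yes (z , _) = ⊥-elim (1+n≰n (subst (_≤ k) (cong proj₁ (sym q)) (ι-level k z)))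
    ... | no _ | no _ with refl ← q = refl

    e* : ∀ {j k} → j ≤′ k → Emb (M j) (M k)
    e* ≤′-refl = id-emb _
    e* (≤′-step p) = e _ ∘ᵉ e* p

    ι-e* : ∀ {j k} (p : j ≤′ k) x → ι k (map (e* p) x) ≡ ι j x
    ι-e* ≤′-refl x = refl
    ι-e* (≤′-step p) x = trans (ι-e _ _) (ι-e* p x)

    reach : ∀ u k → proj₁ u ≤ k → Σ (Carrier (M k)) λ x → ι k x ≡ u
    reach (j , n) k p = map (e* (≤⇒≤′ p)) (element j n) , trans (ι-e* (≤⇒≤′ p) (element j n)) (ι-element j n)

    j≤′j+k : ∀ j k → j ≤′ j + k
    j≤′j+k j k = ≤⇒≤′ (m≤m+n j k)

    k≤′j+k : ∀ j k → k ≤′ j + k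
    k≤′j+k j k = ≤⇒≤′ (m≤n+m k j)

    ι-agree : ∀ {j k} x x′ → ι j x ≡ ι k x′ → map (e* (j≤′j+k j k)) x ≡ map (e* (k≤′j+k j k)) x′
    ι-agree {j} {k} x x′ q = ι-injective (j + k) (trans (ι-e* (j≤′j+k j k) x) (trans q (sym (ι-e* (k≤′j+k j k) x′))))

    Rˡ : Σ ℕ Fresh → Σ ℕ Fresh → Set
    Rˡ u v = Σ ℕ λ k → Σ (Carrier (M k)) λ x → Σ (Carrier (M k)) λ y → ι k x ≡ u × ι k y ≡ v × R (M k) x y

    Rˡ-at : ∀ k {x y u v} → ι k x ≡ u → ι k y ≡ v → Rˡ u v ⇔ R (M k) x y
    Rˡ-at k {x} {y} p q = mk⇔ at (λ r → k , x , y , p , q , r)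
      where
      at : Rˡ _ _ → R (M k) x y
      at (k′ , x′ , y′ , p′ , q′ , r) =
        R-reflect (e* (j≤′j+k k k′))
          (subst₂ (R (M (k + k′))) (sym (ι-agree x x′ (trans p (sym p′)))) (sym (ι-agree y y′ (trans q (sym q′))))
            (R-preserve (e* (k≤′j+k k k′)) r))

    module LimitOperation (h : ∀ k → Carrier (M k) → Carrier (M k))
      (h-hom : ∀ {j k} (p : j ≤′ k) x → map (e* p) (h j x) ≡ h k (map (e* p) x)) where

      hˡ : Σ ℕ Fresh → Σ ℕ Fresh
      hˡ (k , n) = ι k (h k (element k n))

      hˡ-at : ∀ k x {u} → ι k x ≡ u → hˡ u ≡ ι k (h k x)
      hˡ-at k x {k′ , n} q = begin
        ι k′ (h k′ (element k′ n))                             ≡⟨ ι-e* (k≤′j+k k k′) _ ⟨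
        ι (k + k′) (map (e* (k≤′j+k k k′)) (h k′ (element k′ n))) ≡⟨ cong (ι (k + k′)) (h-hom (k≤′j+k k k′) _) ⟩
        ι (k + k′) (h (k + k′) (map (e* (k≤′j+k k k′)) (element k′ n)))
          ≡⟨ cong (λ z → ι (k + k′) (h (k + k′) z)) (ι-agree x (element k′ n) (trans q (sym (ι-element k′ n)))) ⟨
        ι (k + k′) (h (k + k′) (map (e* (j≤′j+k k k′)) x))    ≡⟨ cong (ι (k + k′)) (h-hom (j≤′j+k k k′) x) ⟨
        ι (k + k′) (map (e* (j≤′j+k k k′)) (h k x))           ≡⟨ ι-e* (j≤′j+k k k′) (h k x) ⟩
        ι k (h k x)                                          ∎

    module Limᶠ (i : F) = LimitOperation (λ k → f (M k) i) (λ p → f-hom (e* p) i)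
    module Limᵍ (j : G) = LimitOperation (λ k → g (M k) j) (λ p → g-hom (e* p) j)

    Lim : Str F G
    Lim = record { Carrier = Σ ℕ Fresh ; R = Rˡ ; f = Limᶠ.hˡ ; g = Limᵍ.hˡ }

    ιᵉ : ∀ k → Emb (M k) Lim
    ιᵉ k = record
      { map = ι k
      ; inj = ι-injective k
      ; rel-iff = λ x y → ⇔-sym (Rˡ-at k refl refl)
      ; f-hom = λ i x → sym (Limᶠ.hˡ-at i k x refl)
      ; g-hom = λ j x → sym (Limᵍ.hˡ-at j k x refl)
      }

    Lim-InK : (P : Subset 5) → (∀ k → InK P (M k)) → InK P Lim
    Lim-InK P kM = InK-local P Lim λ u v w →
      let k = proj₁ u + proj₁ v + proj₁ w in
      M k , kM k , ιᵉ k
      , reach u k (≤-trans (m≤m+n _ (proj₁ v)) (m≤m+n _ (proj₁ w)))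
      , reach v k (≤-trans (m≤n+m (proj₁ v) (proj₁ u)) (m≤m+n _ (proj₁ w)))
      , reach w k (m≤n+m (proj₁ w) _)

  -- The Fraïssé limit

  module FraisseConstruction {F G : Set} {a b : ℕ} (φF : F ↔ Fin a) (φG : G ↔ Fin b) (P : Subset 5) where

    FinCode : ℕ → Set
    FinCode N = Vec (Vec Bool N) N × Vec (Vec (Fin N) N) a × Vec (Vec (Fin N) N) b

    decode : ∀ {N} → FinCode N → Str F G
    decode {N} (r , fs , gs) = record
      { Carrier = Fin N
      ; R = λ x y → T (Vec.lookup (Vec.lookup r x) y)
      ; f = λ i x → Vec.lookup (Vec.lookup fs (to φF i)) x
      ; g = λ j x → Vec.lookup (Vec.lookup gs (to φG j)) x
      }

    encode : (S : Str F G) {N : ℕ} → Carrier S ↔ Fin N → FinCode N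
    encode S φ = table (λ x y → isYes (lem (R S (from φ x) (from φ y))))
               , table (λ i x → to φ (f S (from φF i) (from φ x)))
               , table (λ j x → to φ (g S (from φG j) (from φ x)))

    encode-iso : (S : Str F G) {N : ℕ} (φ : Carrier S ↔ Fin N) → Iso S (decode (encode S φ))
    encode-iso S φ = record
      { map = to φ
      ; inj = ↔-injective φ
      ; rel-iff = R-coded
      ; f-hom = λ i x → sym (trans (lookup-table _ (to φF i) (to φ x)) (op-hom (f S) φF i x))
      ; g-hom = λ j x → sym (trans (lookup-table _ (to φG j) (to φ x)) (op-hom (g S) φG j x))
      } , λ y → from φ y , strictlyInverseˡ φ y
      where
      op-hom : ∀ {I : Set} {n} (h : I → Carrier S → Carrier S) (ψ : I ↔ Fin n) i x →
        to φ (h (from ψ (to ψ i)) (from φ (to φ x))) ≡ to φ (h i x)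
      op-hom h ψ i x rewrite strictlyInverseʳ ψ i | strictlyInverseʳ φ x = refl
      R-coded : ∀ x y → R S x y ⇔ R (decode (encode S φ)) (to φ x) (to φ y)
      R-coded x y rewrite lookup-table (λ x y → isYes (lem (R S (from φ x) (from φ y)))) (to φ x) (to φ y)
                    | strictlyInverseʳ φ x | strictlyInverseʳ φ y = mk⇔ fromWitness toWitness

    all-codes : ∀ N → List (FinCode N)
    all-codes N = cartesianProduct (vectors (vectors booleans N) N)
                    (cartesianProduct (vectors (vectors (allFin N) N) a) (vectors (vectors (allFin N) N) b))

    all-codes-exhaustive : ∀ N → Exhaustive (all-codes N)
    all-codes-exhaustive N = cartesianProduct-exhaustive (vectors-exhaustive (vectors-exhaustive booleans-exhaustive N) N)
      (cartesianProduct-exhaustive (vectors-exhaustive (vectors-exhaustive ∈-allFin N) a)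
                                   (vectors-exhaustive (vectors-exhaustive ∈-allFin N) b))

    record FiniteMember : Set₁ where
      field
        str     : Str F G
        str-InK : InK P str
        size    : ℕ
        enum    : Carrier str ↔ Fin size
    open FiniteMember

    Task : FiniteMember → Set
    Task S = Σ ℕ λ m → FinCode (size S + m)

    tasks : (S : FiniteMember) → ℕ → List (Task S)
    tasks S zero = List.map (0 ,_) (all-codes (size S + 0))
    tasks S (suc k) = List.map (suc k ,_) (all-codes (size S + suc k)) ++ tasks S k

    ∈-tasks : ∀ S k m (c : FinCode (size S + m)) → m ≤ k → (m , c) ∈ tasks S k
    ∈-tasks S zero .zero c z≤n = ∈-map⁺ (0 ,_) (all-codes-exhaustive _ c)
    ∈-tasks S (suc k) m c m≤1+k with m≤n⇒m<n∨m≡n m≤1+k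
    ... | inj₁ m<1+k = ∈-++⁺ʳ _ (∈-tasks S k m c (≤-pred m<1+k))
    ... | inj₂ refl = ∈-++⁺ˡ (∈-map⁺ (suc k ,_) (all-codes-exhaustive _ c))

    -- the task (m , c) asks for an extension of S by m points, S sitting in its first size S points
    Extension : (S : FiniteMember) (m : ℕ) → FinCode (size S + m) → Set
    Extension S m c = InK P (decode c) × Σ (Emb (str S) (decode c)) λ e → ∀ x → map e x ≡ to (enum S) x ↑ˡ m

    Above : FiniteMember → Set₁
    Above S = Σ FiniteMember λ T → Emb (str S) (str T)

    module TaskAmalgam (S : FiniteMember) (above : Above S) (m : ℕ) (c : FinCode (size S + m))
      (ext : Extension S m c) where

      open Amalgam P (proj₂ above) (proj₁ (proj₂ ext)) (image-decomposition (proj₁ (proj₂ ext)))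
                   (str-InK (proj₁ above)) (proj₁ ext) public

      result : Above S
      result = record { str = D ; str-InK = D-InK ; size = _ ; enum = ⊎-finite (enum (proj₁ above)) rest-finite }
             , eA ∘ᵉ proj₂ above
        where
        rest-finite = proj₂ (proj₂ (injection-finite (size S + m) proj₁ subtype-≡))

    process : (S : FiniteMember) → Above S → List (Task S) → Above S
    process S above [] = above
    process S above ((m , c) ∷ ts) with lem (Extension S m c)
    ... | yes ext = process S (TaskAmalgam.result S above m c ext) ts
    ... | no _ = process S above ts

    process-grows : ∀ S above ts → Σ (Emb (str (proj₁ above)) (str (proj₁ (process S above ts)))) λ h →
      ∀ x → map h (map (proj₂ above) x) ≡ map (proj₂ (process S above ts)) x
    process-grows S above [] = id-emb _ , λ x → refl
    process-grows S above ((m , c) ∷ ts) with lem (Extension S m c)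
    ... | yes ext = let h , h-commutes = process-grows S (TaskAmalgam.result S above m c ext) ts
                    in h ∘ᵉ TaskAmalgam.eA S above m c ext , h-commutes
    ... | no _ = process-grows S above ts

    process-realizes : ∀ S above ts m (c : FinCode (size S + m)) → (m , c) ∈ ts → Extension S m c →
      Σ (Emb (decode c) (str (proj₁ (process S above ts)))) λ h →
        ∀ x → map h (to (enum S) x ↑ˡ m) ≡ map (proj₂ (process S above ts)) x
    process-realizes S above ((m , c) ∷ ts) m c (here refl) ext′ with lem (Extension S m c)
    ... | no ¬ext = ⊥-elim (¬ext ext′)
    ... | yes ext = h ∘ᵉ eB , λ x → begin
        map h (toD (to (enum S) x ↑ˡ m))   ≡⟨ cong (map h ∘ toD) (proj₂ (proj₂ ext) x) ⟨
        map h (toD (map (proj₁ (proj₂ ext)) x)) ≡⟨ cong (map h) (commute x) ⟨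
        map h (inj₁ (map (proj₂ above) x))  ≡⟨ h-commutes x ⟩
        map (proj₂ (process S (TaskAmalgam.result S above m c ext) ts)) x ∎
      where
      open TaskAmalgam S above m c ext
      h = proj₁ (process-grows S result ts)
      h-commutes = proj₂ (process-grows S result ts)
    process-realizes S above ((m′ , c′) ∷ ts) m c (there q) ext′ with lem (Extension S m′ c′)
    ... | yes ext = process-realizes S (TaskAmalgam.result S above m′ c′ ext) ts m c q ext′
    ... | no _ = process-realizes S above ts m c q ext′

    stage : ℕ → FiniteMember
    stage zero = record { str = ∅ˢ ; str-InK = ∅ˢ-InK P ; size = 0 ; enum = ↔-sym 0↔⊥ }
    stage (suc k) = proj₁ (process (stage k) (stage k , id-emb _) (tasks (stage k) k))

    step : ∀ k → Emb (str (stage k)) (str (stage (suc k)))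
    step k = proj₂ (process (stage k) (stage k , id-emb _) (tasks (stage k) k))

    step-realizes : ∀ k m (c : FinCode (size (stage k) + m)) → m ≤ k → Extension (stage k) m c →
      Σ (Emb (decode c) (str (stage (suc k)))) λ h → ∀ x → map h (to (enum (stage k)) x ↑ˡ m) ≡ map (step k) x
    step-realizes k m c m≤k = process-realizes (stage k) _ (tasks (stage k) k) m c (∈-tasks (stage k) k m c m≤k)

    open DirectLimit (λ k → str (stage k)) step public

    extension-property : (A B : Str F G) {nA nB : ℕ} → Carrier A ↔ Fin nA → InK P B → Carrier B ↔ Fin nB →
      (i : Emb A B) (e : Emb A Lim) → Σ (Emb B Lim) λ e′ → ∀ x → map e′ (map i x) ≡ map e x
    extension-property A B {nB = nB} φA kB φB i e = e′ , e′-extends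
      where
      -- stage j contains the image of A, and the at most nB new points of B make a task of stage j
      bound = finite-upper-bound φA (λ x → proj₁ (map e x))
      j = proj₁ bound + nB
      factored = factor-through (ιᵉ j) e (λ x → reach (map e x) j (≤-trans (proj₂ bound x) (m≤m+n _ nB)))
      eⱼ = proj₁ factored
      module B⊔ = Amalgam P eⱼ i (image-decomposition i) (str-InK (stage j)) kB
      rest-finite = injection-finite nB (λ n → to φB (proj₁ n)) (λ q → subtype-≡ (↔-injective φB q))
      m = proj₁ rest-finite
      φ = ⊎-finite (enum (stage j)) (proj₂ (proj₂ rest-finite))
      coded = encode-iso B⊔.D φ
      realized = step-realizes j m (encode B⊔.D φ) (≤-trans (proj₁ (proj₂ rest-finite)) (m≤n+m nB _))
        (InK-substructure P (Iso-inverse coded) B⊔.D-InK , proj₁ coded ∘ᵉ B⊔.eA , λ x → refl)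
      h = proj₁ realized
      e′ : Emb B Lim
      e′ = ιᵉ (suc j) ∘ᵉ h ∘ᵉ proj₁ coded ∘ᵉ B⊔.eB
      e′-extends : ∀ x → map e′ (map i x) ≡ map e x
      e′-extends x = begin
        ι (suc j) (map h (to φ (B⊔.toD (map i x))))  ≡⟨ cong (λ z → ι (suc j) (map h (to φ z))) (B⊔.commute x) ⟨
        ι (suc j) (map h (to φ (inj₁ (map eⱼ x))))   ≡⟨ cong (ι (suc j)) (proj₂ realized (map eⱼ x)) ⟩
        ι (suc j) (map (step j) (map eⱼ x))          ≡⟨ ι-e j _ ⟩
        ι j (map eⱼ x)                               ≡⟨ proj₂ factored x ⟩
        map e x                                      ∎

    Lim-countable : Countable Lim
    Lim-countable = code , code-injective
      where
      code : Σ ℕ Fresh → ℕ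
      code (k , n) = pair k (toℕ (to (enum (stage k)) (element k n)))
      element-injective : ∀ k {n n′} → element k n ≡ element k n′ → n ≡ n′
      element-injective zero q = q
      element-injective (suc k) q = subtype-≡ q
      code-injective : ∀ {u v} → code u ≡ code v → u ≡ v
      code-injective {k , n} {k′ , n′} q with refl , q′ ← pair-injective {k} {_} {k′} q =
        cong (k ,_) (element-injective k (↔-injective (enum (stage k)) (toℕ-injective q′)))

    Lim∈K : InK P Lim
    Lim∈K = Lim-InK P (λ k → str-InK (stage k))

    finitely-generated-finite : (A : Str F G) → FinitelyGenerated A → Emb A Lim → FiniteSet (Carrier A)
    finitely-generated-finite A (n , gens , generated) e =
      let m , _ , φ = injection-finite (size (stage j)) (λ x → to (enum (stage j)) (map eⱼ x))
                        (λ q → inj eⱼ (↔-injective (enum (stage j)) q))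
      in m , φ
      where
      bound = upper-bound n (λ k → proj₁ (map e (gens k)))
      j = proj₁ bound
      gens-at : ∀ k → Σ (Carrier (str (stage j))) λ x → ι j x ≡ map e (gens k)
      gens-at k = reach (map e (gens k)) j (proj₂ bound k)
      in-stage : ∀ d → InImage (ιᵉ j) (map e d)
      in-stage d = let t , t≡d = generated d in
        (⟦ t ⟧t str (stage j)) (λ k → proj₁ (gens-at k)) , (begin
          ι j ((⟦ t ⟧t str (stage j)) (λ k → proj₁ (gens-at k))) ≡⟨ term-emb (ιᵉ j) t _ ⟩
          (⟦ t ⟧t Lim) (λ k → ι j (proj₁ (gens-at k)))          ≡⟨ term-cong Lim t (λ k → proj₂ (gens-at k)) ⟩
          (⟦ t ⟧t Lim) (λ k → map e (gens k))                    ≡⟨ term-emb e t gens ⟨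
          map e ((⟦ t ⟧t A) gens)                                ≡⟨ cong (map e) t≡d ⟩
          map e d                                                ∎)
      eⱼ = proj₁ (factor-through (ιᵉ j) e in-stage)

    finite-finitely-generated : (A : Str F G) → FiniteSet (Carrier A) → FinitelyGenerated A
    finite-finitely-generated A (n , φ) = n , from φ , λ d → var (to φ d) , strictlyInverseʳ φ d

    Lim-age : AgeIs Lim (Fin-part (InK P))
    Lim-age A = mk⇔
      (λ (fg , e) → finitely-generated-finite A fg e , InK-substructure P e Lim∈K)
      (λ (fin , kA) → finite-finitely-generated A fin
                    , proj₁ (extension-property ∅ˢ A (↔-sym 0↔⊥) kA (proj₂ fin) (∅ˢ-emb A) (∅ˢ-emb Lim)))

    -- a finite partial isomorphism of Lim, given by two embeddings of one finite structure
    Matched : List (Carrier Lim × Carrier Lim) → Set₁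
    Matched l = Σ (Str F G) λ C → FiniteSet (Carrier C) × Σ (Emb C Lim) λ α → Σ (Emb C Lim) λ β →
      ∀ {x y} → (x , y) ∈ l → Σ (Carrier C) λ c → map α c ≡ x × map β c ≡ y

    record Absorbed (C : Str F G) (α β : Emb C Lim) (x : Carrier Lim) : Set₁ where
      field
        j          : ℕ
        αⱼ         : Emb C (str (stage j))
        β′         : Emb (str (stage j)) Lim
        α-factors  : ∀ c → ι j (map αⱼ c) ≡ map α c
        β-factors  : ∀ c → map β′ (map αⱼ c) ≡ map β c
        x-in-stage : InImage (ιᵉ j) x

    absorb-point : (C : Str F G) → FiniteSet (Carrier C) → (α β : Emb C Lim) (x : Carrier Lim) → Absorbed C α β x
    absorb-point C (n , φ) α β x = record
      { j = j
      ; αⱼ = proj₁ factored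
      ; β′ = proj₁ extended
      ; α-factors = proj₂ factored
      ; β-factors = proj₂ extended
      ; x-in-stage = reach x j (m≤n+m _ _)
      }
      where
      bound = finite-upper-bound φ (λ c → proj₁ (map α c))
      j = proj₁ bound + proj₁ x
      factored = factor-through (ιᵉ j) α (λ c → reach (map α c) j (≤-trans (proj₂ bound c) (m≤m+n _ _)))
      extended = extension-property C (str (stage j)) φ (str-InK (stage j)) (enum (stage j)) (proj₁ factored) β

    -- abstract keeps the chain construction folded while the back and forth is checked;
    -- unfolding it exhausts memory
    abstract
      forth : ∀ l x → Matched l → Σ (Carrier Lim) λ y → Matched ((x , y) ∷ l)
      forth l x (C , finC , α , β , matched) =
        map β′ (proj₁ x-in-stage) , str (stage j) , (size (stage j) , enum (stage j)) , ιᵉ j , β′ , matched′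
        where
        open Absorbed (absorb-point C finC α β x)
        matched′ : ∀ {x′ y′} → (x′ , y′) ∈ (x , map β′ (proj₁ x-in-stage)) ∷ l → Σ _ λ c → ι j c ≡ x′ × map β′ c ≡ y′
        matched′ (here refl) = proj₁ x-in-stage , proj₂ x-in-stage , refl
        matched′ (there q) = let c , αc , βc = matched q in map αⱼ c , trans (α-factors c) αc , trans (β-factors c) βc

      back : ∀ l y → Matched l → Σ (Carrier Lim) λ x → Matched ((x , y) ∷ l)
      back l y (C , finC , α , β , matched) =
        map β′ (proj₁ x-in-stage) , str (stage j) , (size (stage j) , enum (stage j)) , β′ , ιᵉ j , matched′
        where
        open Absorbed (absorb-point C finC β α y)
        matched′ : ∀ {x′ y′} → (x′ , y′) ∈ (map β′ (proj₁ x-in-stage) , y) ∷ l → Σ _ λ c → map β′ c ≡ x′ × ι j c ≡ y′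
        matched′ (here refl) = proj₁ x-in-stage , refl , proj₂ x-in-stage
        matched′ (there q) = let c , αc , βc = matched q in map αⱼ c , trans (β-factors c) αc , trans (α-factors c) βc

    matched-coherent : ∀ {l} → Matched l → ∀ {x y x′ y′} → (x , y) ∈ l → (x′ , y′) ∈ l → Coherent Lim Lim x y x′ y′
    matched-coherent (C , _ , α , β , matched) q q′ with matched q | matched q′
    ... | c , refl , refl | c′ , refl , refl =
      (λ e → cong (map β) (inj α e)) ,
      (λ e → cong (map α) (inj β e)) ,
      (rel-iff β c c′ ⇔-∘ ⇔-sym (rel-iff α c c′)) ,
      (λ i e → trans (sym (f-hom β i c)) (cong (map β) (inj α (trans (f-hom α i c) e)))) ,
      (λ i e → trans (sym (g-hom β i c)) (cong (map β) (inj α (trans (g-hom α i c) e))))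

    Lim-ultrahomogeneous : Ultrahomogeneous Lim
    Lim-ultrahomogeneous A fg e₁ e₂ = iso , λ x → iso-extends (∈-map⁺ pair-up (all x))
      where
      finA = finitely-generated-finite A fg e₁
      all = proj₂ (finite-exhaustive (proj₂ finA))
      pair-up : Carrier A → Carrier Lim × Carrier Lim
      pair-up c = map e₁ c , map e₂ c
      matched₀ : Matched (List.map pair-up (proj₁ (finite-exhaustive (proj₂ finA))))
      matched₀ = A , finA , e₁ , e₂ , λ q → let c , _ , e = ∈-map⁻ pair-up q in c , sym (cong proj₁ e) , sym (cong proj₂ e)
      enum-Lim = enumeration (proj₁ Lim-countable) (proj₂ Lim-countable)
      open BackAndForth Lim Lim (proj₁ enum-Lim) (proj₂ enum-Lim) (proj₁ enum-Lim) (proj₂ enum-Lim)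
                        Matched forth back matched-coherent _ matched₀

    Lim-Fraisse : FraisseLimit (Fin-part (InK P)) Lim
    Lim-Fraisse = Lim-countable , Lim-ultrahomogeneous , Lim-age

  Fraisse-limit-exists : {F G : Set} → FiniteSet F → FiniteSet G → (P : Subset 5) →
    Σ (Str F G) (FraisseLimit (Fin-part (InK P)))
  Fraisse-limit-exists (_ , φF) (_ , φG) P = Lim , Lim-Fraisse
    where open FraisseConstruction φF φG P

  -- The theory of the Fraïssé limit in case (A)

  module Span (A : RelStr) {n : ℕ} (ρ : Vector (Carrier A) n) where

    Span : RelStr
    Span = record
      { Carrier = Subtype (λ x → Σ (Fin n) λ i → ρ i ≡ x)
      ; R = λ x y → R A (proj₁ x) (proj₁ y)
      ; f = λ ()
      ; g = λ ()
      }

    point : Fin n → Carrier Span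
    point i = ρ i , fromWitness (i , refl)

    position : Carrier Span → Fin n
    position s = proj₁ (toWitness (proj₂ s))

    ρ-position : ∀ s → ρ (position s) ≡ proj₁ s
    ρ-position s = proj₂ (toWitness (proj₂ s))

    point-position : ∀ s → point (position s) ≡ s
    point-position s = subtype-≡ (ρ-position s)

    inclusion : Emb Span A
    inclusion = record { map = proj₁ ; inj = subtype-≡ ; rel-iff = λ _ _ → ⇔-refl ; f-hom = λ () ; g-hom = λ () }

    Span-generated : FinitelyGenerated Span
    Span-generated = n , point , λ s → var (position s) , point-position s

    Span-finite : FiniteSet (Carrier Span)
    Span-finite =
      let m , _ , φ = injection-finite n position (λ {s} {s′} q → trans (sym (point-position s)) (trans (cong point q) (point-position s′)))
      in m , φ

    module _ (B : RelStr) (ρ′ : Vector (Carrier B) n) (same : SameAtomicType A ρ B ρ′) where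

      Span-emb : Emb Span B
      Span-emb = record
        { map = λ s → ρ′ (position s)
        ; inj = λ {s} {s′} q → subtype-≡ (trans (sym (ρ-position s))
                  (trans (from (proj₁ (same-at same (position s) (position s′))) q) (ρ-position s′)))
        ; rel-iff = λ s s′ → proj₂ (same-at same (position s) (position s′)) ⇔-∘ R-cong A (sym (ρ-position s)) (sym (ρ-position s′))
        ; f-hom = λ ()
        ; g-hom = λ ()
        }

      Span-emb-point : ∀ i → map Span-emb (point i) ≡ ρ′ i
      Span-emb-point i = to (proj₁ (same-at same (position (point i)) i)) (ρ-position (point i))

  diagram-of : (A : RelStr) {n : ℕ} → Vector (Carrier A) n → DiagramCode n
  diagram-of A ρ = table λ i j → isYes (lem (ρ i ≡ ρ j)) , isYes (lem (R A (ρ i) (ρ j)))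

  realizes-diagram-of : (A : RelStr) {n : ℕ} (ρ : Vector (Carrier A) n) → Realizes A ρ (diagram-of A ρ)
  realizes-diagram-of A ρ = realizes realized
    where
    decided : ∀ {X : Set} (d : Dec X) → Signed (isYes d) X
    decided (yes x) = x
    decided (no ¬x) = ¬x
    realized : ∀ i j → Signed (proj₁ (entry (diagram-of A ρ) i j)) (ρ i ≡ ρ j)
                     × Signed (proj₂ (entry (diagram-of A ρ) i j)) (R A (ρ i) (ρ j))
    realized i j rewrite lookup-table (λ i j → isYes (lem (ρ i ≡ ρ j)) , isYes (lem (R A (ρ i) (ρ j)))) i j =
      decided (lem (ρ i ≡ ρ j)) , decided (lem (R A (ρ i) (ρ j)))

  module TheoryOfFraisseLimit (P : Subset 5) (M : RelStr) (M-Fraisse : FraisseLimit (Fin-part (InK P)) M) where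

    M-ultrahomogeneous : Ultrahomogeneous M
    M-ultrahomogeneous = proj₁ (proj₂ M-Fraisse)

    M-age : AgeIs M (Fin-part (InK P))
    M-age = proj₂ (proj₂ M-Fraisse)

    same-type-automorphism : ∀ {n} (ρ ρ′ : Vector (Carrier M) n) → SameAtomicType M ρ M ρ′ →
      Σ (Iso M M) λ σ → ∀ i → map (proj₁ σ) (ρ i) ≡ ρ′ i
    same-type-automorphism ρ ρ′ same = proj₁ u , λ i → trans (proj₂ u (point i)) (Span-emb-point M ρ′ same i)
      where
      open Span M ρ
      u = M-ultrahomogeneous Span Span-generated inclusion (Span-emb M ρ′ same)

    Th-M-complete : (A : RelStr) → Model (Th M) A → ∀ σ → A ⊨ˢ σ → M ⊨ˢ σ
    Th-M-complete A A⊨ σ h with lem (M ⊨ˢ σ)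
    ... | yes M⊨σ = M⊨σ
    ... | no M⊭σ = ⊥-elim (A⊨ (σ ⇒ ⊥ᶠ) (lift M⊭σ) h)

    -- φ is equivalent to the disjunction of the diagrams of the tuples satisfying it in M
    Th-M-QE : QE (Th M)
    Th-M-QE n φ = ψ , ⋁-diagrams-QF types , λ A A⊨ ρ →
      let h = to (⊨-∀* A n _) (A⊨ χ (lift (from (⊨-∀* M n _) (λ ρ → to (in-M ρ) , from (in-M ρ))))) ρ
      in mk⇔ (proj₁ h) (proj₂ h)
      where
      Witnessed : DiagramCode n → Set
      Witnessed δ = Σ (Vector (Carrier M) n) λ ρ′ → Realizes M ρ′ δ × M ⊨ φ [ ρ′ ]
      types = filter (λ δ → lem (Witnessed δ)) (all-diagrams n)
      ψ = ⋁-diagrams types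
      χ = ∀* n ((φ ⇒ ψ) ∧ᶠ (ψ ⇒ φ))
      in-M : ∀ ρ → (M ⊨ φ [ ρ ]) ⇔ (M ⊨ ψ [ ρ ])
      in-M ρ = mk⇔ (λ h → from (⊨-⋁-diagrams M types ρ) (δ , ∈-filter⁺ _ (all-diagrams-exhaustive n δ) (ρ , own , h) , own)) back
        where
        δ = diagram-of M ρ
        own = realizes-diagram-of M ρ
        back : M ⊨ ψ [ ρ ] → M ⊨ φ [ ρ ]
        back h with δ′ , q , r ← to (⊨-⋁-diagrams M types ρ) h with ρ′ , r′ , h′ ← proj₂ (∈-filter⁻ (λ δ → lem (Witnessed δ)) {xs = all-diagrams n} q)
          with σ , σρ′≡ρ ← same-type-automorphism ρ′ ρ (realizers-same-type δ′ r′ r)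
          = to (⊨-cong M φ σρ′≡ρ) (to (Iso-preserves σ φ ρ′) h′)

    Th-M-model-complete : ModelComplete (Th M)
    Th-M-model-complete A B A⊨ B⊨ e n φ ρ =
      ⇔-sym (eliminates B B⊨ (λ k → map e (ρ k))) ⇔-∘ (QF-emb e qf ρ ⇔-∘ eliminates A A⊨ ρ)
      where
      qf = proj₁ (proj₂ (Th-M-QE n φ))
      eliminates = proj₂ (proj₂ (Th-M-QE n φ))

    -- by ultrahomogeneity the type of (x ∷ ā) is realized in M over every tuple of the type of ā;
    -- Th M contains this as a sentence, which B then satisfies
    extend-same-type : (A B : RelStr) → Model (Th M) A → Model (Th M) B →
      ∀ {n} (ā : Vector (Carrier A) n) (b̄ : Vector (Carrier B) n) → SameAtomicType A ā B b̄ →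
      (x : Carrier A) → Σ (Carrier B) λ y → SameAtomicType A (x ∷ᵛ ā) B (y ∷ᵛ b̄)
    extend-same-type A B A⊨ B⊨ {n} ā b̄ same x =
      proj₁ y , realizers-same-type δ (realizes-diagram-of A (x ∷ᵛ ā)) (to (⊨-diagram B δ (proj₁ y ∷ᵛ b̄)) (proj₂ y))
      where
      δ = diagram-of A (x ∷ᵛ ā)
      δ₀ = diagram-of A ā
      in-M : Σ (Vector (Carrier M) (suc n)) λ ρ → M ⊨ diagram δ [ ρ ]
      in-M = to (⊨-∃* M (suc n) (diagram δ)) (Th-M-complete A A⊨ (∃* (suc n) (diagram δ))
               (from (⊨-∃* A (suc n) (diagram δ)) (x ∷ᵛ ā , from (⊨-diagram A δ (x ∷ᵛ ā)) (realizes-diagram-of A (x ∷ᵛ ā)))))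
      ρc = proj₁ in-M
      extends : ∀ ρ → M ⊨ diagram δ₀ [ ρ ] → M ⊨ ∃ᶠ (diagram δ) [ ρ ]
      extends ρ ρ⊨δ₀ = map (proj₁ σ) (ρc zero) , to (⊨-cong M (diagram δ) σ-on-ρc) (to (Iso-preserves σ (diagram δ) ρc) (proj₂ in-M))
        where
        ρc-type : SameAtomicType A ā M (λ k → ρc (suc k))
        ρc-type = same-type-tail (same-type-cong (λ _ → refl) (∷-η ρc)
                    (realizers-same-type δ (realizes-diagram-of A (x ∷ᵛ ā)) (to (⊨-diagram M δ ρc) (proj₂ in-M))))
        ρ-type : SameAtomicType A ā M ρ
        ρ-type = realizers-same-type δ₀ (realizes-diagram-of A ā) (to (⊨-diagram M δ₀ ρ) ρ⊨δ₀)
        automorphism = same-type-automorphism (λ k → ρc (suc k)) ρ (same-type-trans (same-type-sym ρc-type) ρ-type)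
        σ = proj₁ automorphism
        σ-on-ρc : ∀ k → map (proj₁ σ) (ρc k) ≡ (map (proj₁ σ) (ρc zero) ∷ᵛ ρ) k
        σ-on-ρc zero = refl
        σ-on-ρc (suc k) = proj₂ automorphism k
      extension-axiom = diagram δ₀ ⇒ ∃ᶠ (diagram δ)
      y = to (⊨-∀* B n extension-axiom) (B⊨ (∀* n extension-axiom) (lift (from (⊨-∀* M n extension-axiom) extends))) b̄
            (from (⊨-diagram B δ₀ b̄) (same-type-realizes δ₀ same (realizes-diagram-of A ā)))

    Th-M-ωCategorical : ωCategorical (Th M)
    Th-M-ωCategorical A B A⊨ B⊨ φA φB = BackAndForth.iso A B
      (λ n → just (from φA n)) (λ x → to φA x , cong just (strictlyInverseʳ φA x))
      (λ n → just (from φB n)) (λ y → to φB y , cong just (strictlyInverseʳ φB y))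
      Good forth back coherent [] (same-type λ ())
      where
      Pairs = List (Carrier A × Carrier B)
      firsts : (l : Pairs) → Vector (Carrier A) (length l)
      firsts l i = proj₁ (List.lookup l i)
      seconds : (l : Pairs) → Vector (Carrier B) (length l)
      seconds l i = proj₂ (List.lookup l i)
      Good : Pairs → Set
      Good l = SameAtomicType A (firsts l) B (seconds l)
      cons-lookup : ∀ {X : Set} (l : Pairs) (h : Carrier A × Carrier B → X) p i →
        (h p ∷ᵛ (λ k → h (List.lookup l k))) i ≡ h (List.lookup (p ∷ l) i)
      cons-lookup l h p zero = refl
      cons-lookup l h p (suc i) = refl
      forth : ∀ l x → Good l → Σ (Carrier B) λ y → Good ((x , y) ∷ l)
      forth l x good = let y , t = extend-same-type A B A⊨ B⊨ (firsts l) (seconds l) good x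
                       in y , same-type-cong (cons-lookup l proj₁ (x , y)) (cons-lookup l proj₂ (x , y)) t
      back : ∀ l y → Good l → Σ (Carrier A) λ x → Good ((x , y) ∷ l)
      back l y good = let x , t = extend-same-type B A B⊨ A⊨ (seconds l) (firsts l) (same-type-sym good) y
                      in x , same-type-cong (cons-lookup l proj₁ (x , y)) (cons-lookup l proj₂ (x , y)) (same-type-sym t)
      coherent : ∀ {l} → Good l → ∀ {x y x′ y′} → (x , y) ∈ l → (x′ , y′) ∈ l → Coherent A B x y x′ y′
      coherent {l} good {x} {y} {x′} {y′} q q′ = to ≡⇔≡ , from ≡⇔≡ , R⇔R , (λ ()) , (λ ())
        where
        e = lookup-index q
        e′ = lookup-index q′
        at = same-at good (index q) (index q′)
        ≡⇔≡ : (x ≡ x′) ⇔ (y ≡ y′)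
        ≡⇔≡ = ≡-cong-⇔ (sym (cong proj₂ e)) (sym (cong proj₂ e′)) ⇔-∘ (proj₁ at ⇔-∘ ≡-cong-⇔ (cong proj₁ e) (cong proj₁ e′))
        R⇔R : R A x x′ ⇔ R B y y′
        R⇔R = R-cong B (sym (cong proj₂ e)) (sym (cong proj₂ e′)) ⇔-∘ (proj₂ at ⇔-∘ R-cong A (cong proj₁ e) (cong proj₁ e′))

    M-InK : InK P M
    M-InK = InK-local P M λ x y z → spanned x y z
      where
      spanned : ∀ x y z → Σ RelStr λ Y → InK P Y × Σ (Emb Y M) λ e → InImage e x × InImage e y × InImage e z
      spanned x y z = Span , proj₂ (to (M-age Span) (Span-generated , inclusion)) , inclusion
                    , (point zero , refl) , (point (suc zero) , refl) , (point (suc (suc zero)) , refl)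
        where open Span M (x ∷ᵛ y ∷ᵛ z ∷ᵛ []ᵛ)

    axiom : Fin 5 → Sentence ⊥ ⊥
    axiom transitive = ∀ᶠ (∀ᶠ (∀ᶠ ((rel v₂ v₁ ∧ᶠ rel v₁ v₀) ⇒ rel v₂ v₀)))
      where v₀ = var zero ; v₁ = var (suc zero) ; v₂ = var (suc (suc zero))
    axiom reflexive = ∀ᶠ (rel (var zero) (var zero))
    axiom symmetric = ∀ᶠ (∀ᶠ (rel (var (suc zero)) (var zero) ⇒ rel (var zero) (var (suc zero))))
    axiom antireflexive = ∀ᶠ (rel (var zero) (var zero) ⇒ ⊥ᶠ)
    axiom antisymmetric = ∀ᶠ (∀ᶠ ((rel v₁ v₀ ∧ᶠ rel v₀ v₁) ⇒ (v₁ ≐ v₀)))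
      where v₀ = var zero ; v₁ = var (suc zero)

    axiom-sound : (A : RelStr) (i : Fin 5) → RelProp i (R A) → A ⊨ˢ axiom i
    axiom-sound A transitive t x y z (r , r′) = t r r′
    axiom-sound A reflexive t = t
    axiom-sound A symmetric t x y r = t r
    axiom-sound A antireflexive t = t
    axiom-sound A antisymmetric t x y (r , r′) = t r r′

    axiom-complete : (A : RelStr) (i : Fin 5) → A ⊨ˢ axiom i → RelProp i (R A)
    axiom-complete A transitive h {x} {y} {z} r r′ = h x y z (r , r′)
    axiom-complete A reflexive h = h
    axiom-complete A symmetric h {x} {y} r = h x y r
    axiom-complete A antireflexive h = h
    axiom-complete A antisymmetric h {x} {y} r r′ = h x y (r , r′)

    ThK-model-InK : (A : RelStr) → Model (ThK (InK P)) A → InK P A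
    ThK-model-InK A A⊨ = (λ i p → axiom-complete A i (A⊨ (axiom i) (λ C kC → axiom-sound C i (proj₁ kC i p))))
                        , (λ ()) , (λ ())

    universal-transfer : (D : RelStr) → InK P D → ∀ {n} (φ : Formula ⊥ ⊥ n) → Universal φ →
      (∀ ρ → M ⊨ φ [ ρ ]) → ∀ ρ → D ⊨ φ [ ρ ]
    universal-transfer D kD φ (univ-qf q) M⊨φ ρ =
      to (QF-emb inclusion q point) (from (QF-emb into-M q point) (M⊨φ _))
      where
      open Span D ρ
      into-M = proj₂ (from (M-age Span) (Span-finite , InK-substructure P inclusion kD))
    universal-transfer D kD (∀ᶠ φ) (univ-∀ u) M⊨φ ρ d =
      universal-transfer D kD φ u (λ ρ′ → from (⊨-cong M φ (∷-η ρ′)) (M⊨φ (λ k → ρ′ (suc k)) (ρ′ zero))) (d ∷ᵛ ρ)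

    Th-M-universal-consequences : SameUniversalConsequences (ThK (InK P)) (Th M)
    Th-M-universal-consequences σ u = mk⇔
      (λ K⊢σ D D⊨ → D⊨ σ (lift (K⊢σ M (λ τ K⊨τ → K⊨τ M M-InK))))
      (λ M⊢σ D D⊨ → universal-transfer D (ThK-model-InK D D⊨) σ u
                       (λ ρ → to (⊨-cong M σ (λ ())) (M⊢σ M (λ τ → lower))) _)

    ThK-AP : AP (ThK (InK P))
    ThK-AP A B C A⊨ B⊨ C⊨ iA iB =
      let D , kD , eA , eB , commutes , _ = superSAP P A B C (ThK-model-InK A A⊨) (ThK-model-InK B B⊨) (ThK-model-InK C C⊨) iA iB
      in D , (λ σ K⊨σ → K⊨σ D kD) , eA , eB , commutes

    theory : ωCategorical (Th M) × QE (Th M) × ModelCompletion (Th M) (ThK (InK P))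
    theory = Th-M-ωCategorical , Th-M-QE , Th-M-model-complete , Th-M-universal-consequences , ThK-AP

⊥-finite : FiniteSet ⊥
⊥-finite = 0 , ↔-sym 0↔⊥

⊤-finite : FiniteSet ⊤
⊤-finite = 1 , ↔-sym 1↔⊤

proposition2p1 : ExcludedMiddle →
  -- (A)
  ((P : Subset 5) → SuperSAP (InK {⊥} {⊥} P))
  -- (B)
  × ((P : Subset 5) → SuperSAP (InK {⊤} {⊥} P))
  -- (C)
  × ((P : Subset 5) → SuperSAP (InK {⊥} {⊤} P))
  -- (D)
  × ((F G : Set) (P : Subset 5) → SuperSAP (InK {F} {G} P))
  -- Fraisse limits of the finite parts
  × ((P : Subset 5) → Σ (Str ⊥ ⊥) (FraisseLimit (Fin-part (InK P))))
  × ((P : Subset 5) → Σ (Str ⊤ ⊥) (FraisseLimit (Fin-part (InK P))))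
  × ((P : Subset 5) → Σ (Str ⊥ ⊤) (FraisseLimit (Fin-part (InK P))))
  × ((F G : Set) → FiniteSet F → FiniteSet G → (P : Subset 5) →
       Σ (Str F G) (FraisseLimit (Fin-part (InK P))))
  -- model theory of the limit in case (A)
  × ((P : Subset 5) (M : Str ⊥ ⊥) → FraisseLimit (Fin-part (InK P)) M →
       ωCategorical (Th M) × QE (Th M) × ModelCompletion (Th M) (ThK (InK P)))
proposition2p1 lem =
  superSAP , superSAP , superSAP , (λ _ _ → superSAP) ,
  Fraisse-limit-exists ⊥-finite ⊥-finite ,
  Fraisse-limit-exists ⊤-finite ⊥-finite ,
  Fraisse-limit-exists ⊥-finite ⊤-finite ,
  (λ _ _ → Fraisse-limit-exists) ,
  TheoryOfFraisseLimit.theory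
  where open Classical lem
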